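{- Let $q\in\mathbb{N}$ be odd and square-free. Then if $Q$ is an integral ternary quadratic form with $(\det(Q),q)=1$ we have \[m(Q;q)\ll q^{1/2}\,\widehat{m}(-Q^{\mathrm{adj}};q)^{1/2},\] with an absolute implied constant. In particular one has \[B_3^*(q)\ll q^{1/2}\,\widehat{B}_3(q)^{1/2}.\]
   Context: $\|\cdot\|$ is the Euclidean norm. For an integral quadratic form $Q$ in $n$ variables: $m(Q;q):=\min\{\|\mathbf{x}\|:\mathbf{x}\in\mathbb{Z}^n\setminus\{\mathbf{0}\},\ Q(\mathbf{x})\equiv 0\pmod q\}$ and $\widehat{m}(Q;q):=\min\{\|\mathbf{x}\|:\mathbf{x}\in\mathbb{Z}^n\setminus\{\mathbf{0}\},\ \exists t\in\mathbb{Z},\ Q(\mathbf{x})\equiv t^2\pmod q\}$ (this depends only on $Q$ modulo $q$). $\det(Q)$ is the determinant of the symmetric matrix $M$ of $Q$; since $q$ is odd, $M$ may be viewed as a symmetric matrix over $\mathbb{Z}/q\mathbb{Z}$, and $(\det(Q),q)=1$ means $\det M$ is a unit mod $q$. $Q^{\mathrm{adj}}$ is the quadratic form (modulo $q$, lifted to any integral form) whose matrix is the adjugate matrix of $M$ over $\mathbb{Z}/q\mathbb{Z}$. $B_3^*(q):=\max_Q m(Q;q)$ over integral ternary forms $Q$ with $(\det(Q),q)=1$, and $\widehat{B}_n(q):=\max_Q\widehat{m}(Q;q)$ over integral quadratic forms $Q$ in $n$ variables with $(\det(Q),q)=1$. -}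

module Defs where

open import Data.Nat as ℕ using (ℕ; _/_)
open import Data.Nat.Coprimality using (Coprime)
open import Data.Nat.Divisibility using () renaming (_∣_ to _∣ℕ_)
open import Data.Integer using (ℤ; +_; _+_; _-_; _*_; -_; ∣_∣; _≤_)
open import Data.Integer.Divisibility using () renaming (_∣_ to _∣ℤ_)
open import Data.Fin using (Fin; zero; suc)
open import Data.Product using (∃; ∃-syntax; _×_; Σ)
open import Relation.Binary.PropositionalEquality using (_≡_; _≢_)
open import Relation.Nullary using (¬_)

_≡_[mod_] : ℤ → ℤ → ℕ → Set
a ≡ b [mod q ] = (+ q) ∣ℤ (a - b)

Odd : ℕ → Set
Odd q = ¬ (2 ∣ℕ q)

SquareFree : ℕ → Set
SquareFree q = ∀ (d : ℕ) → (d ℕ.* d) ∣ℕ q → d ≡ 1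

Vec3 : Set
Vec3 = Fin 3 → ℤ

Mat3 : Set
Mat3 = Fin 3 → Fin 3 → ℤ

NonZeroVec : Vec3 → Set
NonZeroVec x = ∃[ i ] (x i ≢ + 0)

normSq : Vec3 → ℤ
normSq x = x zero * x zero + x (suc zero) * x (suc zero)
           + x (suc (suc zero)) * x (suc (suc zero))

record Ternary : Set where
  constructor ternary
  field
    a11 a22 a33 a12 a13 a23 : ℤ

evalQ : Ternary → Vec3 → ℤ
evalQ Q x = a11 * x1 * x1 + a22 * x2 * x2 + a33 * x3 * x3
          + a12 * x1 * x2 + a13 * x1 * x3 + a23 * x2 * x3
  where
  open Ternary Q
  x1 = x zero
  x2 = x (suc zero)
  x3 = x (suc (suc zero))

-- The symmetric matrix M of Q, viewed over ℤ/qℤ (q odd), represented by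
-- an integer lift: off-diagonal entries a_ij · h with h = (q+1)/2 ≡ 2⁻¹ (mod q).
matQ : ℕ → Ternary → Mat3
matQ q Q = M
  where
  open Ternary Q
  h : ℤ
  h = + ((ℕ.suc q) / 2)
  M : Mat3
  M zero zero = a11
  M (suc zero) (suc zero) = a22
  M (suc (suc zero)) (suc (suc zero)) = a33
  M zero (suc zero) = a12 * h
  M (suc zero) zero = a12 * h
  M zero (suc (suc zero)) = a13 * h
  M (suc (suc zero)) zero = a13 * h
  M (suc zero) (suc (suc zero)) = a23 * h
  M (suc (suc zero)) (suc zero) = a23 * h

det3 : Mat3 → ℤ
det3 M = m 0 0 * (m 1 1 * m 2 2 - m 1 2 * m 2 1)
       - m 0 1 * (m 1 0 * m 2 2 - m 1 2 * m 2 0)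
       + m 0 2 * (m 1 0 * m 2 1 - m 1 1 * m 2 0)
  where
  f : ℕ → Fin 3
  f 0 = zero
  f 1 = suc zero
  f _ = suc (suc zero)
  m : ℕ → ℕ → ℤ
  m i j = M (f i) (f j)

adj3 : Mat3 → Mat3
adj3 M i j = cof j i
  where
  f : ℕ → Fin 3
  f 0 = zero
  f 1 = suc zero
  f _ = suc (suc zero)
  m : ℕ → ℕ → ℤ
  m i j = M (f i) (f j)
  cof : Fin 3 → Fin 3 → ℤ
  cof zero zero = m 1 1 * m 2 2 - m 1 2 * m 2 1
  cof zero (suc zero) = - (m 1 0 * m 2 2 - m 1 2 * m 2 0)
  cof zero (suc (suc zero)) = m 1 0 * m 2 1 - m 1 1 * m 2 0
  cof (suc zero) zero = - (m 0 1 * m 2 2 - m 0 2 * m 2 1)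
  cof (suc zero) (suc zero) = m 0 0 * m 2 2 - m 0 2 * m 2 0
  cof (suc zero) (suc (suc zero)) = - (m 0 0 * m 2 1 - m 0 1 * m 2 0)
  cof (suc (suc zero)) zero = m 0 1 * m 1 2 - m 0 2 * m 1 1
  cof (suc (suc zero)) (suc zero) = - (m 0 0 * m 1 2 - m 0 2 * m 1 0)
  cof (suc (suc zero)) (suc (suc zero)) = m 0 0 * m 1 1 - m 0 1 * m 1 0

matForm : Mat3 → Vec3 → ℤ
matForm A x = row zero + row (suc zero) + row (suc (suc zero))
  where
  row : Fin 3 → ℤ
  row i = A i zero * x i * x zero + A i (suc zero) * x i * x (suc zero)
        + A i (suc (suc zero)) * x i * x (suc (suc zero))

DetCoprime : ℕ → Ternary → Set
DetCoprime q Q = Coprime ∣ det3 (matQ q Q) ∣ q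

QadjEval : ℕ → Ternary → Vec3 → ℤ
QadjEval q Q = matForm (adj3 (matQ q Q))

IsotropicMod : ℕ → (Vec3 → ℤ) → Vec3 → Set
IsotropicMod q F x = NonZeroVec x × (F x ≡ + 0 [mod q ])

SquareMod : ℕ → (Vec3 → ℤ) → Vec3 → Set
SquareMod q F y = NonZeroVec y × (∃[ t ] (F y ≡ t * t [mod q ]))

module Submission where

-- If y ≠ 0 and −yᵀadj(M)y ≡ t² (mod q), then Q has a nonzero isotropic
-- vector x modulo q with ‖x‖⁴ ≤ 432 q² ‖y‖², i.e. m(Q;q) ≪ q^{1/2} m̂(−Q^adj;q)^{1/2};
-- a least isotropic x then gives the bound against every y admissible for the
-- form −Q^adj, whose determinant −det(M)² is again a unit, hence B₃*(q) ≪ q^{1/2} B̂₃(q)^{1/2}.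
--
-- The proof, for any square-free n in place of q:
--  * local step (LocalLine): for a prime p ∤ y the plane y^⊥ contains a nonzero
--    isotropic v of Q mod p, obtained from a basis u, w of y^⊥ via the Gram identity
--    Q(u)Q(w) − (uᵀMw)² = adj(M)(u × w); the linear form ℓ_p = v × e then cuts the
--    line through v out of y^⊥, so y·x ≡ ℓ_p·x ≡ 0 (mod p) forces p ∣ Q(x);
--  * gluing (Gluing): the residues of the ℓ_p, p ∣ n, sort ℤ³ into n classes such that
--    two vectors of one class with the same value of y·_ differ by an isotropic vector;
--  * counting (box-collision): the pigeonhole principle in a box of side H ≈ √(n‖y‖₁)
--    yields such a difference, which is short (NatBounds);
--  * induction (short-isotropic): a common factor g of n and y is removed by passing
--    to (n/g, y/g, g⁻¹t);
--  * the assertions of the theorem are then translated into the language of Defs,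
--    where the off-diagonal entries a_ij/2 of M are a_ij·(q+1)/2.
-- Vectors are handled through their coordinates, so that every polynomial identity
-- is a single call of the integer ring solver.

module NatBounds where

  open import Data.Nat
  open import Data.Nat.Properties
  open import Data.Product using (Σ; _,_; _×_)
  open import Data.Sum using (inj₁; inj₂)
  open import Relation.Nullary using (yes; no)
  open import Relation.Binary.PropositionalEquality using (_≡_; refl; cong; sym; subst)
  open import Data.Nat.Tactic.RingSolver using (solve-∀)

  m≤m*m : ∀ m → m ≤ m * m
  m≤m*m zero = z≤n
  m≤m*m (suc k) = m≤m*n (suc k) (suc k)

  approxSqrt : ∀ m → Σ ℕ λ H → m ≤ H * H × H * H ≤ 4 * m
  approxSqrt zero = 0 , z≤n , z≤n
  approxSqrt (suc m) with approxSqrt m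
  ... | H , m≤H² , H²≤4m with suc m ≤? H * H
  ... | yes m<H² = H , m<H² , ≤-trans H²≤4m (*-monoʳ-≤ 4 (n≤1+n m))
  ... | no m≮H² = suc H , lower , upper
    where
    H²≡m : H * H ≡ m
    H²≡m = ≤-antisym (≤-pred (≰⇒> m≮H²)) m≤H²
    square-suc : ∀ k → suc k * suc k ≡ suc (k * k + 2 * k)
    square-suc = solve-∀
    H≤H²+1 : H ≤ H * H + 1
    H≤H²+1 = ≤-trans (m≤m*m H) (m≤m+n (H * H) 1)
    lower : suc m ≤ suc H * suc H
    lower = begin
      suc m ≡⟨ cong suc (sym H²≡m) ⟩
      suc (H * H) ≤⟨ s≤s (m≤m+n (H * H) (2 * H)) ⟩
      suc (H * H + 2 * H) ≡⟨ sym (square-suc H) ⟩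
      suc H * suc H ∎
      where open ≤-Reasoning
    upper : suc H * suc H ≤ 4 * suc m
    upper = begin
      suc H * suc H ≡⟨ square-suc H ⟩
      suc (H * H + 2 * H) ≤⟨ s≤s (+-monoʳ-≤ (H * H) (*-monoʳ-≤ 2 H≤H²+1)) ⟩
      suc (H * H + 2 * (H * H + 1)) ≤⟨ s≤s (m≤m+n _ (H * H + 1)) ⟩
      suc (H * H + 2 * (H * H + 1) + (H * H + 1)) ≡⟨ four-times H ⟩
      4 * suc (H * H) ≡⟨ cong (λ k → 4 * suc k) H²≡m ⟩
      4 * suc m ∎
      where
      open ≤-Reasoning
      four-times : ∀ k → suc (k * k + 2 * (k * k + 1) + (k * k + 1)) ≡ 4 * suc (k * k)
      four-times = solve-∀

  -- The pigeonhole count: if n·s ≤ H² with s ≥ 1, the (H+1)³ points of the box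
  -- {0,…,H}³ outnumber the n·(sH+1) classes (residue class, value of a linear
  -- form with coefficient sum s).
  boxOutnumbers : ∀ n s H → 1 ≤ s → n * s ≤ H * H → n * suc (s * H) < suc H * (suc H * suc H)
  boxOutnumbers n s@(suc _) H _ ns≤H² = begin-strict
    n * suc (s * H) ≡⟨ *-suc n (s * H) ⟩
    n + n * (s * H) ≡⟨ cong (n +_) (sym (*-assoc n s H)) ⟩
    n + n * s * H ≤⟨ +-mono-≤ (≤-trans (m≤m*n n s) ns≤H²) (*-monoˡ-≤ H ns≤H²) ⟩
    H * H + H * H * H <⟨ s≤s (m≤m+n _ _) ⟩
    suc (H * H + H * H * H) + (2 * (H * H) + 3 * H) ≡⟨ cube-suc H ⟩
    suc H * (suc H * suc H) ∎
    where
    open ≤-Reasoning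
    cube-suc : ∀ k → suc (k * k + k * k * k) + (2 * (k * k) + 3 * k) ≡ suc k * (suc k * suc k)
    cube-suc = solve-∀

  twice-product≤sum-squares : ∀ a b → 2 * (a * b) ≤ a * a + b * b
  twice-product≤sum-squares a b with ≤-total a b
  ... | inj₁ a≤b with m≤n⇒∃[o]m+o≡n a≤b
  ...   | d , refl = subst (2 * (a * (a + d)) ≤_) (sym (expand a d)) (m≤m+n _ (d * d))
    where
    expand : ∀ a d → a * a + (a + d) * (a + d) ≡ 2 * (a * (a + d)) + d * d
    expand = solve-∀
  twice-product≤sum-squares a b | inj₂ b≤a with m≤n⇒∃[o]m+o≡n b≤a
  ...   | d , refl = subst (2 * ((b + d) * b) ≤_) (sym (expand b d)) (m≤m+n _ (d * d))
    where
    expand : ∀ b d → (b + d) * (b + d) + b * b ≡ 2 * ((b + d) * b) + d * d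
    expand = solve-∀

  square-sum≤3·sum-squares : ∀ a b c → (a + b + c) * (a + b + c) ≤ 3 * (a * a + b * b + c * c)
  square-sum≤3·sum-squares a b c = begin
    (a + b + c) * (a + b + c) ≡⟨ expand a b c ⟩
    a * a + b * b + c * c + 2 * (a * b) + 2 * (b * c) + 2 * (a * c)
      ≤⟨ +-mono-≤ (+-mono-≤ (+-monoʳ-≤ (a * a + b * b + c * c) (twice-product≤sum-squares a b))
                            (twice-product≤sum-squares b c))
                  (twice-product≤sum-squares a c) ⟩
    a * a + b * b + c * c + (a * a + b * b) + (b * b + c * c) + (a * a + c * c) ≡⟨ collect a b c ⟩
    3 * (a * a + b * b + c * c) ∎
    where
    open ≤-Reasoning
    expand : ∀ a b c → (a + b + c) * (a + b + c) ≡ a * a + b * b + c * c + 2 * (a * b) + 2 * (b * c) + 2 * (a * c)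
    expand = solve-∀
    collect : ∀ a b c → a * a + b * b + c * c + (a * a + b * b) + (b * b + c * c) + (a * a + c * c) ≡ 3 * (a * a + b * b + c * c)
    collect = solve-∀

  -- The final estimate: with H² ≤ 4ns, s² ≤ 3Y (Y = ‖y‖², s = ‖y‖₁) and a vector
  -- of squared norm X ≤ 3H², one gets X² ≤ 432 n² Y.
  boxVector-bound : ∀ n s H Y X → H * H ≤ 4 * (n * s) → s * s ≤ 3 * Y → X ≤ 3 * (H * H) →
                    X * X ≤ 432 * (n * n) * Y
  boxVector-bound n s H Y X H²≤4ns s²≤3Y X≤3H² = begin
    X * X ≤⟨ *-mono-≤ X≤3H² X≤3H² ⟩
    3 * (H * H) * (3 * (H * H)) ≡⟨ nine H ⟩
    9 * ((H * H) * (H * H)) ≤⟨ *-monoʳ-≤ 9 (*-mono-≤ H²≤4ns H²≤4ns) ⟩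
    9 * ((4 * (n * s)) * (4 * (n * s))) ≡⟨ hundred-forty-four n s ⟩
    144 * (n * n) * (s * s) ≤⟨ *-monoʳ-≤ (144 * (n * n)) s²≤3Y ⟩
    144 * (n * n) * (3 * Y) ≡⟨ collect n Y ⟩
    432 * (n * n) * Y ∎
    where
    open ≤-Reasoning
    nine : ∀ k → 3 * (k * k) * (3 * (k * k)) ≡ 9 * ((k * k) * (k * k))
    nine = solve-∀
    hundred-forty-four : ∀ n s → 9 * ((4 * (n * s)) * (4 * (n * s))) ≡ 144 * (n * n) * (s * s)
    hundred-forty-four = solve-∀
    collect : ∀ n Y → 144 * (n * n) * (3 * Y) ≡ 432 * (n * n) * Y
    collect = solve-∀

open import Data.Nat as ℕ using (ℕ)
import Data.Nat.Properties as ℕP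
import Data.Nat.Divisibility as ℕD
open import Data.Nat.Divisibility using () renaming (_∣_ to _∣ℕ_)
open import Data.Nat.Coprimality using (Coprime; coprime-divisor; coprime-Bézout) renaming (sym to coprime-sym)
open import Data.Nat.GCD using (gcd; gcd[m,n]∣m; gcd[m,n]∣n; gcd-greatest; gcd[m,n]≢0; module Bézout)
open import Data.Nat.Primality using (Prime; euclidsLemma; prime⇒irreducible; ¬prime[1]; prime⇒nonZero)
open import Data.Nat.Primality.Factorisation using (factorise; PrimeFactorisation)
open import Data.Nat.ListAction using (product)
open import Data.Nat.DivMod using (m≡m%n+[m/n]*n; m%n<n; m*n/n≡m)
open import Data.Integer
open import Data.Integer.Properties
open import Data.Integer.Divisibility.Signed renaming (_∣_ to _∣ℤ_)
open import Data.Integer.DivMod using (n%ℕd<d; a≡a%ℕn+[a/ℕn]*n)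
open import Data.Integer.Solver using (module +-*-Solver)
open +-*-Solver using (solve; _:=_; _:+_; _:*_; :-_; _:-_; con; Polynomial)
open import Data.Fin using (Fin; toℕ; fromℕ<; combine; remQuot) renaming (zero to fzero; suc to fsuc; _<_ to _<ᶠ_)
open import Data.Fin.Properties using (combine-injectiveˡ; combine-injectiveʳ; combine-remQuot; toℕ-fromℕ<; toℕ-injective; toℕ≤pred[n]; pigeonhole; any?) renaming (<⇒≢ to <⇒≢ᶠ)
open import Data.List using (List; []; _∷_)
open import Data.List.Relation.Unary.All using (All; []; _∷_)
open import Data.Product
open import Data.Sum using (_⊎_; inj₁; inj₂)
open import Data.Empty using (⊥; ⊥-elim)
open import Relation.Nullary using (¬_; Dec; yes; no)
open import Relation.Nullary.Decidable using (_×-dec_; _⊎-dec_)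
open import Relation.Binary.PropositionalEquality
open import Defs
open import Data.Nat.Tactic.RingSolver using (solve-∀)
open import Data.Nat.Induction using (<-rec)

-- The polynomial expressions of the argument, written once over an arbitrary
-- signature (+, ·, −, 2) so that each can be read both as an integer (instance Z)
-- and as a polynomial for the ring solver (instance Syn); every polynomial identity
-- below is then proved by one call to the solver.  A symmetric matrix
-- [[a d e] [d b f] [e f c]] is given by its six entries a b c d e f.
module Expressions {A : Set} (add mul : A → A → A) (neg : A → A) (two : A) where
  infixl 6 _⊕_ _⊝_
  infixl 7 _⊗_
  infix 8 ⊖_

  _⊕_ _⊗_ _⊝_ : A → A → A
  _⊕_ = add
  _⊗_ = mul

  ⊖_ : A → A
  ⊖_ = neg

  x ⊝ y = x ⊕ (⊖ y)

  form : A → A → A → A → A → A → A → A → A → A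
  form a b c d e f u₁ u₂ u₃ =
    a ⊗ u₁ ⊗ u₁ ⊕ b ⊗ u₂ ⊗ u₂ ⊕ c ⊗ u₃ ⊗ u₃ ⊕ two ⊗ (d ⊗ u₁ ⊗ u₂ ⊕ e ⊗ u₁ ⊗ u₃ ⊕ f ⊗ u₂ ⊗ u₃)

  polar : A → A → A → A → A → A → A → A → A → A → A → A → A
  polar a b c d e f u₁ u₂ u₃ w₁ w₂ w₃ =
    a ⊗ u₁ ⊗ w₁ ⊕ b ⊗ u₂ ⊗ w₂ ⊕ c ⊗ u₃ ⊗ w₃
    ⊕ d ⊗ (u₁ ⊗ w₂ ⊕ u₂ ⊗ w₁) ⊕ e ⊗ (u₁ ⊗ w₃ ⊕ u₃ ⊗ w₁) ⊕ f ⊗ (u₂ ⊗ w₃ ⊕ u₃ ⊗ w₂)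

  adjForm : A → A → A → A → A → A → A → A → A → A
  adjForm a b c d e f =
    form (b ⊗ c ⊝ f ⊗ f) (a ⊗ c ⊝ e ⊗ e) (a ⊗ b ⊝ d ⊗ d) (e ⊗ f ⊝ d ⊗ c) (d ⊗ f ⊝ e ⊗ b) (d ⊗ e ⊝ a ⊗ f)

  dot : A → A → A → A → A → A → A
  dot u₁ u₂ u₃ w₁ w₂ w₃ = u₁ ⊗ w₁ ⊕ u₂ ⊗ w₂ ⊕ u₃ ⊗ w₃

  cross₁ cross₂ cross₃ : A → A → A → A → A → A → A
  cross₁ u₁ u₂ u₃ w₁ w₂ w₃ = u₂ ⊗ w₃ ⊝ u₃ ⊗ w₂
  cross₂ u₁ u₂ u₃ w₁ w₂ w₃ = u₃ ⊗ w₁ ⊝ u₁ ⊗ w₃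
  cross₃ u₁ u₂ u₃ w₁ w₂ w₃ = u₁ ⊗ w₂ ⊝ u₂ ⊗ w₁

  vec3 : A → A → A → Fin 3 → A
  vec3 x₁ x₂ x₃ fzero = x₁
  vec3 x₁ x₂ x₃ (fsuc fzero) = x₂
  vec3 x₁ x₂ x₃ (fsuc (fsuc fzero)) = x₃

  -- Generic versions of the matrix operations of Defs, to compare them with the above.
  symMatrix : A → A → A → A → A → A → Fin 3 → Fin 3 → A
  symMatrix a b c d e f = M
    where
    M : Fin 3 → Fin 3 → A
    M fzero fzero = a
    M (fsuc fzero) (fsuc fzero) = b
    M (fsuc (fsuc fzero)) (fsuc (fsuc fzero)) = c
    M fzero (fsuc fzero) = d
    M (fsuc fzero) fzero = d
    M fzero (fsuc (fsuc fzero)) = e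
    M (fsuc (fsuc fzero)) fzero = e
    M (fsuc fzero) (fsuc (fsuc fzero)) = f
    M (fsuc (fsuc fzero)) (fsuc fzero) = f

  private
    index : ℕ → Fin 3
    index 0 = fzero
    index 1 = fsuc fzero
    index _ = fsuc (fsuc fzero)

  det′ : (Fin 3 → Fin 3 → A) → A
  det′ M = m 0 0 ⊗ (m 1 1 ⊗ m 2 2 ⊝ m 1 2 ⊗ m 2 1)
         ⊝ m 0 1 ⊗ (m 1 0 ⊗ m 2 2 ⊝ m 1 2 ⊗ m 2 0)
         ⊕ m 0 2 ⊗ (m 1 0 ⊗ m 2 1 ⊝ m 1 1 ⊗ m 2 0)
    where
    m : ℕ → ℕ → A
    m i j = M (index i) (index j)

  adjugate′ : (Fin 3 → Fin 3 → A) → Fin 3 → Fin 3 → A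
  adjugate′ M i j = cof j i
    where
    m : ℕ → ℕ → A
    m i j = M (index i) (index j)
    cof : Fin 3 → Fin 3 → A
    cof fzero fzero = m 1 1 ⊗ m 2 2 ⊝ m 1 2 ⊗ m 2 1
    cof fzero (fsuc fzero) = ⊖ (m 1 0 ⊗ m 2 2 ⊝ m 1 2 ⊗ m 2 0)
    cof fzero (fsuc (fsuc fzero)) = m 1 0 ⊗ m 2 1 ⊝ m 1 1 ⊗ m 2 0
    cof (fsuc fzero) fzero = ⊖ (m 0 1 ⊗ m 2 2 ⊝ m 0 2 ⊗ m 2 1)
    cof (fsuc fzero) (fsuc fzero) = m 0 0 ⊗ m 2 2 ⊝ m 0 2 ⊗ m 2 0
    cof (fsuc fzero) (fsuc (fsuc fzero)) = ⊖ (m 0 0 ⊗ m 2 1 ⊝ m 0 1 ⊗ m 2 0)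
    cof (fsuc (fsuc fzero)) fzero = m 0 1 ⊗ m 1 2 ⊝ m 0 2 ⊗ m 1 1
    cof (fsuc (fsuc fzero)) (fsuc fzero) = ⊖ (m 0 0 ⊗ m 1 2 ⊝ m 0 2 ⊗ m 1 0)
    cof (fsuc (fsuc fzero)) (fsuc (fsuc fzero)) = m 0 0 ⊗ m 1 1 ⊝ m 0 1 ⊗ m 1 0

  matForm′ : (Fin 3 → Fin 3 → A) → (Fin 3 → A) → A
  matForm′ B x = row fzero ⊕ row (fsuc fzero) ⊕ row (fsuc (fsuc fzero))
    where
    row : Fin 3 → A
    row i = B i fzero ⊗ x i ⊗ x fzero ⊕ B i (fsuc fzero) ⊗ x i ⊗ x (fsuc fzero)
          ⊕ B i (fsuc (fsuc fzero)) ⊗ x i ⊗ x (fsuc (fsuc fzero))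

  evalQ′ : A → A → A → A → A → A → (Fin 3 → A) → A
  evalQ′ a₁₁ a₂₂ a₃₃ a₁₂ a₁₃ a₂₃ x =
    a₁₁ ⊗ x₁ ⊗ x₁ ⊕ a₂₂ ⊗ x₂ ⊗ x₂ ⊕ a₃₃ ⊗ x₃ ⊗ x₃ ⊕ a₁₂ ⊗ x₁ ⊗ x₂ ⊕ a₁₃ ⊗ x₁ ⊗ x₃ ⊕ a₂₃ ⊗ x₂ ⊗ x₃
    where
    x₁ = x fzero
    x₂ = x (fsuc fzero)
    x₃ = x (fsuc (fsuc fzero))

module Z = Expressions _+_ _*_ -_ (+ 2)
module Syn {n : ℕ} = Expressions {Polynomial n} _:+_ _:*_ :-_ (con (+ 2))

∣-by : ∀ {k a b} → a ≡ b → k ∣ℤ a → k ∣ℤ b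
∣-by refl k∣a = k∣a

∣-zero : ∀ {k} → k ∣ℤ 0ℤ
∣-zero {k} = divides 0ℤ (sym (*-zeroˡ k))

-- Nonzero vectors are
-- NotAll (_≡ 0ℤ), vectors that are nonzero modulo k are NotAll (k ∣ℤ_).
NotAll : (ℤ → Set) → ℤ → ℤ → ℤ → Set
NotAll R x₁ x₂ x₃ = R x₁ → R x₂ → R x₃ → ⊥

module _ {p : ℕ} (p-prime : Prime p) where

  p-prime-divides-product : ∀ a b → + p ∣ℤ a * b → + p ∣ℤ a ⊎ + p ∣ℤ b
  p-prime-divides-product a b p∣ab
    with euclidsLemma ∣ a ∣ ∣ b ∣ p-prime (subst (p ∣ℕ_) (abs-* a b) (∣⇒∣ᵤ p∣ab))
  ... | inj₁ p∣a = inj₁ (∣ᵤ⇒∣ p∣a)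
  ... | inj₂ p∣b = inj₂ (∣ᵤ⇒∣ p∣b)

  cancel-factor : ∀ {a b} → ¬ (+ p ∣ℤ a) → + p ∣ℤ a * b → + p ∣ℤ b
  cancel-factor {a} {b} p∤a p∣ab with p-prime-divides-product a b p∣ab
  ... | inj₁ p∣a = ⊥-elim (p∤a p∣a)
  ... | inj₂ p∣b = p∣b

  cancel-square : ∀ {a b} → ¬ (+ p ∣ℤ a) → + p ∣ℤ a * a * b → + p ∣ℤ b
  cancel-square {a} {b} p∤a p∣aab = cancel-factor p∤a (cancel-factor p∤a (∣-by (*-assoc a a b) p∣aab))

polar-as-product : ∀ a b c d e f u₁ u₂ u₃ w₁ w₂ w₃ → Z.polar a b c d e f u₁ u₂ u₃ w₁ w₂ w₃ ≡
  u₁ * (a * w₁ + d * w₂ + e * w₃) + u₂ * (d * w₁ + b * w₂ + f * w₃) + u₃ * (e * w₁ + f * w₂ + c * w₃)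
polar-as-product = solve 12 (λ a b c d e f u₁ u₂ u₃ w₁ w₂ w₃ → Syn.polar a b c d e f u₁ u₂ u₃ w₁ w₂ w₃ :=
  u₁ :* (a :* w₁ :+ d :* w₂ :+ e :* w₃) :+ u₂ :* (d :* w₁ :+ b :* w₂ :+ f :* w₃) :+ u₃ :* (e :* w₁ :+ f :* w₂ :+ c :* w₃)) refl

-- vᵢ² Q(x) = xᵢ² Q(v) + (uᵀMw) where u is a vector built from the cross product
-- v × x with i-th entry 0; this is how "x is parallel to v" transfers isotropy.
form-times-square₁ : ∀ a b c d e f v₁ v₂ v₃ x₁ x₂ x₃ → v₁ * v₁ * Z.form a b c d e f x₁ x₂ x₃ ≡
  Z.polar a b c d e f 0ℤ (Z.cross₃ v₁ v₂ v₃ x₁ x₂ x₃) (- Z.cross₂ v₁ v₂ v₃ x₁ x₂ x₃) (v₁ * x₁ + x₁ * v₁) (v₁ * x₂ + x₁ * v₂) (v₁ * x₃ + x₁ * v₃)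
  + x₁ * x₁ * Z.form a b c d e f v₁ v₂ v₃
form-times-square₁ = solve 12 (λ a b c d e f v₁ v₂ v₃ x₁ x₂ x₃ → v₁ :* v₁ :* Syn.form a b c d e f x₁ x₂ x₃ :=
  Syn.polar a b c d e f (con 0ℤ) (Syn.cross₃ v₁ v₂ v₃ x₁ x₂ x₃) (:- Syn.cross₂ v₁ v₂ v₃ x₁ x₂ x₃) (v₁ :* x₁ :+ x₁ :* v₁) (v₁ :* x₂ :+ x₁ :* v₂) (v₁ :* x₃ :+ x₁ :* v₃)
  :+ x₁ :* x₁ :* Syn.form a b c d e f v₁ v₂ v₃) refl

form-times-square₂ : ∀ a b c d e f v₁ v₂ v₃ x₁ x₂ x₃ → v₂ * v₂ * Z.form a b c d e f x₁ x₂ x₃ ≡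
  Z.polar a b c d e f (- Z.cross₃ v₁ v₂ v₃ x₁ x₂ x₃) 0ℤ (Z.cross₁ v₁ v₂ v₃ x₁ x₂ x₃) (v₂ * x₁ + x₂ * v₁) (v₂ * x₂ + x₂ * v₂) (v₂ * x₃ + x₂ * v₃)
  + x₂ * x₂ * Z.form a b c d e f v₁ v₂ v₃
form-times-square₂ = solve 12 (λ a b c d e f v₁ v₂ v₃ x₁ x₂ x₃ → v₂ :* v₂ :* Syn.form a b c d e f x₁ x₂ x₃ :=
  Syn.polar a b c d e f (:- Syn.cross₃ v₁ v₂ v₃ x₁ x₂ x₃) (con 0ℤ) (Syn.cross₁ v₁ v₂ v₃ x₁ x₂ x₃) (v₂ :* x₁ :+ x₂ :* v₁) (v₂ :* x₂ :+ x₂ :* v₂) (v₂ :* x₃ :+ x₂ :* v₃)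
  :+ x₂ :* x₂ :* Syn.form a b c d e f v₁ v₂ v₃) refl

form-times-square₃ : ∀ a b c d e f v₁ v₂ v₃ x₁ x₂ x₃ → v₃ * v₃ * Z.form a b c d e f x₁ x₂ x₃ ≡
  Z.polar a b c d e f (Z.cross₂ v₁ v₂ v₃ x₁ x₂ x₃) (- Z.cross₁ v₁ v₂ v₃ x₁ x₂ x₃) 0ℤ (v₃ * x₁ + x₃ * v₁) (v₃ * x₂ + x₃ * v₂) (v₃ * x₃ + x₃ * v₃)
  + x₃ * x₃ * Z.form a b c d e f v₁ v₂ v₃
form-times-square₃ = solve 12 (λ a b c d e f v₁ v₂ v₃ x₁ x₂ x₃ → v₃ :* v₃ :* Syn.form a b c d e f x₁ x₂ x₃ :=
  Syn.polar a b c d e f (Syn.cross₂ v₁ v₂ v₃ x₁ x₂ x₃) (:- Syn.cross₁ v₁ v₂ v₃ x₁ x₂ x₃) (con 0ℤ) (v₃ :* x₁ :+ x₃ :* v₁) (v₃ :* x₂ :+ x₃ :* v₂) (v₃ :* x₃ :+ x₃ :* v₃)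
  :+ x₃ :* x₃ :* Syn.form a b c d e f v₁ v₂ v₃) refl

-- (y·e)(v × x)ᵢ = (v × e)ᵢ (y·x) − yᵢ ((v × e)·x) + (y·v)(e × x)ᵢ: if x is
-- orthogonal to y and to v × e, and v to y, then v × x vanishes (given y·e ≠ 0).
cross-decomposition₁ : ∀ v₁ v₂ v₃ e₁ e₂ e₃ x₁ x₂ x₃ y₁ y₂ y₃ →
  Z.dot y₁ y₂ y₃ e₁ e₂ e₃ * Z.cross₁ v₁ v₂ v₃ x₁ x₂ x₃ ≡
  Z.cross₁ v₁ v₂ v₃ e₁ e₂ e₃ * Z.dot y₁ y₂ y₃ x₁ x₂ x₃ - y₁ * Z.dot (Z.cross₁ v₁ v₂ v₃ e₁ e₂ e₃) (Z.cross₂ v₁ v₂ v₃ e₁ e₂ e₃) (Z.cross₃ v₁ v₂ v₃ e₁ e₂ e₃) x₁ x₂ x₃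
  + Z.dot y₁ y₂ y₃ v₁ v₂ v₃ * Z.cross₁ e₁ e₂ e₃ x₁ x₂ x₃
cross-decomposition₁ = solve 12 (λ v₁ v₂ v₃ e₁ e₂ e₃ x₁ x₂ x₃ y₁ y₂ y₃ →
  Syn.dot y₁ y₂ y₃ e₁ e₂ e₃ :* Syn.cross₁ v₁ v₂ v₃ x₁ x₂ x₃ :=
  Syn.cross₁ v₁ v₂ v₃ e₁ e₂ e₃ :* Syn.dot y₁ y₂ y₃ x₁ x₂ x₃ :- y₁ :* Syn.dot (Syn.cross₁ v₁ v₂ v₃ e₁ e₂ e₃) (Syn.cross₂ v₁ v₂ v₃ e₁ e₂ e₃) (Syn.cross₃ v₁ v₂ v₃ e₁ e₂ e₃) x₁ x₂ x₃
  :+ Syn.dot y₁ y₂ y₃ v₁ v₂ v₃ :* Syn.cross₁ e₁ e₂ e₃ x₁ x₂ x₃) refl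

cross-decomposition₂ : ∀ v₁ v₂ v₃ e₁ e₂ e₃ x₁ x₂ x₃ y₁ y₂ y₃ →
  Z.dot y₁ y₂ y₃ e₁ e₂ e₃ * Z.cross₂ v₁ v₂ v₃ x₁ x₂ x₃ ≡
  Z.cross₂ v₁ v₂ v₃ e₁ e₂ e₃ * Z.dot y₁ y₂ y₃ x₁ x₂ x₃ - y₂ * Z.dot (Z.cross₁ v₁ v₂ v₃ e₁ e₂ e₃) (Z.cross₂ v₁ v₂ v₃ e₁ e₂ e₃) (Z.cross₃ v₁ v₂ v₃ e₁ e₂ e₃) x₁ x₂ x₃
  + Z.dot y₁ y₂ y₃ v₁ v₂ v₃ * Z.cross₂ e₁ e₂ e₃ x₁ x₂ x₃
cross-decomposition₂ = solve 12 (λ v₁ v₂ v₃ e₁ e₂ e₃ x₁ x₂ x₃ y₁ y₂ y₃ →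
  Syn.dot y₁ y₂ y₃ e₁ e₂ e₃ :* Syn.cross₂ v₁ v₂ v₃ x₁ x₂ x₃ :=
  Syn.cross₂ v₁ v₂ v₃ e₁ e₂ e₃ :* Syn.dot y₁ y₂ y₃ x₁ x₂ x₃ :- y₂ :* Syn.dot (Syn.cross₁ v₁ v₂ v₃ e₁ e₂ e₃) (Syn.cross₂ v₁ v₂ v₃ e₁ e₂ e₃) (Syn.cross₃ v₁ v₂ v₃ e₁ e₂ e₃) x₁ x₂ x₃
  :+ Syn.dot y₁ y₂ y₃ v₁ v₂ v₃ :* Syn.cross₂ e₁ e₂ e₃ x₁ x₂ x₃) refl

cross-decomposition₃ : ∀ v₁ v₂ v₃ e₁ e₂ e₃ x₁ x₂ x₃ y₁ y₂ y₃ →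
  Z.dot y₁ y₂ y₃ e₁ e₂ e₃ * Z.cross₃ v₁ v₂ v₃ x₁ x₂ x₃ ≡
  Z.cross₃ v₁ v₂ v₃ e₁ e₂ e₃ * Z.dot y₁ y₂ y₃ x₁ x₂ x₃ - y₃ * Z.dot (Z.cross₁ v₁ v₂ v₃ e₁ e₂ e₃) (Z.cross₂ v₁ v₂ v₃ e₁ e₂ e₃) (Z.cross₃ v₁ v₂ v₃ e₁ e₂ e₃) x₁ x₂ x₃
  + Z.dot y₁ y₂ y₃ v₁ v₂ v₃ * Z.cross₃ e₁ e₂ e₃ x₁ x₂ x₃
cross-decomposition₃ = solve 12 (λ v₁ v₂ v₃ e₁ e₂ e₃ x₁ x₂ x₃ y₁ y₂ y₃ →
  Syn.dot y₁ y₂ y₃ e₁ e₂ e₃ :* Syn.cross₃ v₁ v₂ v₃ x₁ x₂ x₃ :=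
  Syn.cross₃ v₁ v₂ v₃ e₁ e₂ e₃ :* Syn.dot y₁ y₂ y₃ x₁ x₂ x₃ :- y₃ :* Syn.dot (Syn.cross₁ v₁ v₂ v₃ e₁ e₂ e₃) (Syn.cross₂ v₁ v₂ v₃ e₁ e₂ e₃) (Syn.cross₃ v₁ v₂ v₃ e₁ e₂ e₃) x₁ x₂ x₃
  :+ Syn.dot y₁ y₂ y₃ v₁ v₂ v₃ :* Syn.cross₃ e₁ e₂ e₃ x₁ x₂ x₃) refl

gram-adjugate : ∀ a b c d e f u₁ u₂ u₃ w₁ w₂ w₃ →
  Z.form a b c d e f u₁ u₂ u₃ * Z.form a b c d e f w₁ w₂ w₃ - Z.polar a b c d e f u₁ u₂ u₃ w₁ w₂ w₃ * Z.polar a b c d e f u₁ u₂ u₃ w₁ w₂ w₃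
  ≡ Z.adjForm a b c d e f (Z.cross₁ u₁ u₂ u₃ w₁ w₂ w₃) (Z.cross₂ u₁ u₂ u₃ w₁ w₂ w₃) (Z.cross₃ u₁ u₂ u₃ w₁ w₂ w₃)
gram-adjugate = solve 12 (λ a b c d e f u₁ u₂ u₃ w₁ w₂ w₃ →
  Syn.form a b c d e f u₁ u₂ u₃ :* Syn.form a b c d e f w₁ w₂ w₃ :- Syn.polar a b c d e f u₁ u₂ u₃ w₁ w₂ w₃ :* Syn.polar a b c d e f u₁ u₂ u₃ w₁ w₂ w₃
  := Syn.adjForm a b c d e f (Syn.cross₁ u₁ u₂ u₃ w₁ w₂ w₃) (Syn.cross₂ u₁ u₂ u₃ w₁ w₂ w₃) (Syn.cross₃ u₁ u₂ u₃ w₁ w₂ w₃)) refl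

form-scale : ∀ a b c d e f y₁ y₂ y₃ s → Z.form a b c d e f (y₁ * s) (y₂ * s) (y₃ * s) ≡ s * s * Z.form a b c d e f y₁ y₂ y₃
form-scale = solve 10 (λ a b c d e f y₁ y₂ y₃ s → Syn.form a b c d e f (y₁ :* s) (y₂ :* s) (y₃ :* s) := s :* s :* Syn.form a b c d e f y₁ y₂ y₃) refl

adjForm-scale : ∀ a b c d e f y₁ y₂ y₃ s → Z.adjForm a b c d e f (y₁ * s) (y₂ * s) (y₃ * s) ≡ s * s * Z.adjForm a b c d e f y₁ y₂ y₃
adjForm-scale = solve 10 (λ a b c d e f y₁ y₂ y₃ s → Syn.adjForm a b c d e f (y₁ :* s) (y₂ :* s) (y₃ :* s) := s :* s :* Syn.adjForm a b c d e f y₁ y₂ y₃) refl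

form-combination : ∀ a b c d e f α β u₁ u₂ u₃ w₁ w₂ w₃ →
  Z.form a b c d e f (α * u₁ + β * w₁) (α * u₂ + β * w₂) (α * u₃ + β * w₃) ≡
  α * α * Z.form a b c d e f u₁ u₂ u₃ + + 2 * α * β * Z.polar a b c d e f u₁ u₂ u₃ w₁ w₂ w₃ + β * β * Z.form a b c d e f w₁ w₂ w₃
form-combination = solve 14 (λ a b c d e f α β u₁ u₂ u₃ w₁ w₂ w₃ →
  Syn.form a b c d e f (α :* u₁ :+ β :* w₁) (α :* u₂ :+ β :* w₂) (α :* u₃ :+ β :* w₃) :=
  α :* α :* Syn.form a b c d e f u₁ u₂ u₃ :+ con (+ 2) :* α :* β :* Syn.polar a b c d e f u₁ u₂ u₃ w₁ w₂ w₃ :+ β :* β :* Syn.form a b c d e f w₁ w₂ w₃) refl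

dot-combination : ∀ α β u₁ u₂ u₃ w₁ w₂ w₃ y₁ y₂ y₃ →
  Z.dot y₁ y₂ y₃ (α * u₁ + β * w₁) (α * u₂ + β * w₂) (α * u₃ + β * w₃) ≡ α * Z.dot y₁ y₂ y₃ u₁ u₂ u₃ + β * Z.dot y₁ y₂ y₃ w₁ w₂ w₃
dot-combination = solve 11 (λ α β u₁ u₂ u₃ w₁ w₂ w₃ y₁ y₂ y₃ →
  Syn.dot y₁ y₂ y₃ (α :* u₁ :+ β :* w₁) (α :* u₂ :+ β :* w₂) (α :* u₃ :+ β :* w₃) := α :* Syn.dot y₁ y₂ y₃ u₁ u₂ u₃ :+ β :* Syn.dot y₁ y₂ y₃ w₁ w₂ w₃) refl

dot-sub : ∀ y₁ y₂ y₃ z₁ z₂ z₃ w₁ w₂ w₃ → Z.dot y₁ y₂ y₃ (z₁ - w₁) (z₂ - w₂) (z₃ - w₃) ≡ Z.dot y₁ y₂ y₃ z₁ z₂ z₃ - Z.dot y₁ y₂ y₃ w₁ w₂ w₃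
dot-sub = solve 9 (λ y₁ y₂ y₃ z₁ z₂ z₃ w₁ w₂ w₃ → Syn.dot y₁ y₂ y₃ (z₁ :- w₁) (z₂ :- w₂) (z₃ :- w₃) := Syn.dot y₁ y₂ y₃ z₁ z₂ z₃ :- Syn.dot y₁ y₂ y₃ w₁ w₂ w₃) refl

cross-combination₁ : ∀ α β u₁ u₂ u₃ w₁ w₂ w₃ → Z.cross₁ u₁ u₂ u₃ (α * u₁ + β * w₁) (α * u₂ + β * w₂) (α * u₃ + β * w₃) ≡ β * Z.cross₁ u₁ u₂ u₃ w₁ w₂ w₃
cross-combination₁ = solve 8 (λ α β u₁ u₂ u₃ w₁ w₂ w₃ → Syn.cross₁ u₁ u₂ u₃ (α :* u₁ :+ β :* w₁) (α :* u₂ :+ β :* w₂) (α :* u₃ :+ β :* w₃) := β :* Syn.cross₁ u₁ u₂ u₃ w₁ w₂ w₃) refl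

cross-combination₂ : ∀ α β u₁ u₂ u₃ w₁ w₂ w₃ → Z.cross₂ u₁ u₂ u₃ (α * u₁ + β * w₁) (α * u₂ + β * w₂) (α * u₃ + β * w₃) ≡ β * Z.cross₂ u₁ u₂ u₃ w₁ w₂ w₃
cross-combination₂ = solve 8 (λ α β u₁ u₂ u₃ w₁ w₂ w₃ → Syn.cross₂ u₁ u₂ u₃ (α :* u₁ :+ β :* w₁) (α :* u₂ :+ β :* w₂) (α :* u₃ :+ β :* w₃) := β :* Syn.cross₂ u₁ u₂ u₃ w₁ w₂ w₃) refl

cross-combination₃ : ∀ α β u₁ u₂ u₃ w₁ w₂ w₃ → Z.cross₃ u₁ u₂ u₃ (α * u₁ + β * w₁) (α * u₂ + β * w₂) (α * u₃ + β * w₃) ≡ β * Z.cross₃ u₁ u₂ u₃ w₁ w₂ w₃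
cross-combination₃ = solve 8 (λ α β u₁ u₂ u₃ w₁ w₂ w₃ → Syn.cross₃ u₁ u₂ u₃ (α :* u₁ :+ β :* w₁) (α :* u₂ :+ β :* w₂) (α :* u₃ :+ β :* w₃) := β :* Syn.cross₃ u₁ u₂ u₃ w₁ w₂ w₃) refl

-- For each coordinate of y there is an explicit such pair, with s equal to that
-- coordinate; one of them has p ∤ s as soon as y is nonzero modulo p.
record PlaneBasis (y₁ y₂ y₃ : ℤ) : Set where
  constructor planeBasis
  field
    u₁ u₂ u₃ w₁ w₂ w₃ s : ℤ
    u⊥y : Z.dot y₁ y₂ y₃ u₁ u₂ u₃ ≡ 0ℤ
    w⊥y : Z.dot y₁ y₂ y₃ w₁ w₂ w₃ ≡ 0ℤ
    u×w₁ : Z.cross₁ u₁ u₂ u₃ w₁ w₂ w₃ ≡ y₁ * s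
    u×w₂ : Z.cross₂ u₁ u₂ u₃ w₁ w₂ w₃ ≡ y₂ * s
    u×w₃ : Z.cross₃ u₁ u₂ u₃ w₁ w₂ w₃ ≡ y₃ * s

planeBasis₁ : ∀ y₁ y₂ y₃ → Σ (PlaneBasis y₁ y₂ y₃) λ B → PlaneBasis.s B ≡ y₁
planeBasis₁ y₁ y₂ y₃ = planeBasis (- y₃) 0ℤ y₁ y₂ (- y₁) 0ℤ y₁
  (solve 3 (λ y₁ y₂ y₃ → Syn.dot y₁ y₂ y₃ (:- y₃) (con 0ℤ) y₁ := con 0ℤ) refl y₁ y₂ y₃)
  (solve 3 (λ y₁ y₂ y₃ → Syn.dot y₁ y₂ y₃ y₂ (:- y₁) (con 0ℤ) := con 0ℤ) refl y₁ y₂ y₃)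
  (solve 3 (λ y₁ y₂ y₃ → Syn.cross₁ (:- y₃) (con 0ℤ) y₁ y₂ (:- y₁) (con 0ℤ) := y₁ :* y₁) refl y₁ y₂ y₃)
  (solve 3 (λ y₁ y₂ y₃ → Syn.cross₂ (:- y₃) (con 0ℤ) y₁ y₂ (:- y₁) (con 0ℤ) := y₂ :* y₁) refl y₁ y₂ y₃)
  (solve 3 (λ y₁ y₂ y₃ → Syn.cross₃ (:- y₃) (con 0ℤ) y₁ y₂ (:- y₁) (con 0ℤ) := y₃ :* y₁) refl y₁ y₂ y₃) , refl

planeBasis₂ : ∀ y₁ y₂ y₃ → Σ (PlaneBasis y₁ y₂ y₃) λ B → PlaneBasis.s B ≡ y₂
planeBasis₂ y₁ y₂ y₃ = planeBasis y₂ (- y₁) 0ℤ 0ℤ y₃ (- y₂) y₂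
  (solve 3 (λ y₁ y₂ y₃ → Syn.dot y₁ y₂ y₃ y₂ (:- y₁) (con 0ℤ) := con 0ℤ) refl y₁ y₂ y₃)
  (solve 3 (λ y₁ y₂ y₃ → Syn.dot y₁ y₂ y₃ (con 0ℤ) y₃ (:- y₂) := con 0ℤ) refl y₁ y₂ y₃)
  (solve 3 (λ y₁ y₂ y₃ → Syn.cross₁ y₂ (:- y₁) (con 0ℤ) (con 0ℤ) y₃ (:- y₂) := y₁ :* y₂) refl y₁ y₂ y₃)
  (solve 3 (λ y₁ y₂ y₃ → Syn.cross₂ y₂ (:- y₁) (con 0ℤ) (con 0ℤ) y₃ (:- y₂) := y₂ :* y₂) refl y₁ y₂ y₃)
  (solve 3 (λ y₁ y₂ y₃ → Syn.cross₃ y₂ (:- y₁) (con 0ℤ) (con 0ℤ) y₃ (:- y₂) := y₃ :* y₂) refl y₁ y₂ y₃) , refl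

planeBasis₃ : ∀ y₁ y₂ y₃ → Σ (PlaneBasis y₁ y₂ y₃) λ B → PlaneBasis.s B ≡ y₃
planeBasis₃ y₁ y₂ y₃ = planeBasis 0ℤ y₃ (- y₂) (- y₃) 0ℤ y₁ y₃
  (solve 3 (λ y₁ y₂ y₃ → Syn.dot y₁ y₂ y₃ (con 0ℤ) y₃ (:- y₂) := con 0ℤ) refl y₁ y₂ y₃)
  (solve 3 (λ y₁ y₂ y₃ → Syn.dot y₁ y₂ y₃ (:- y₃) (con 0ℤ) y₁ := con 0ℤ) refl y₁ y₂ y₃)
  (solve 3 (λ y₁ y₂ y₃ → Syn.cross₁ (con 0ℤ) y₃ (:- y₂) (:- y₃) (con 0ℤ) y₁ := y₁ :* y₃) refl y₁ y₂ y₃)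
  (solve 3 (λ y₁ y₂ y₃ → Syn.cross₂ (con 0ℤ) y₃ (:- y₂) (:- y₃) (con 0ℤ) y₁ := y₂ :* y₃) refl y₁ y₂ y₃)
  (solve 3 (λ y₁ y₂ y₃ → Syn.cross₃ (con 0ℤ) y₃ (:- y₂) (:- y₃) (con 0ℤ) y₁ := y₃ :* y₃) refl y₁ y₂ y₃) , refl

-- Then the plane y^⊥ contains an isotropic vector v of
-- Q modulo p, and the linear form ℓ = v × e (with y·e ≢ 0) cuts out the line
-- through v inside y^⊥: every x with y·x ≡ ℓ·x ≡ 0 is parallel to v and hence
-- isotropic modulo p.
module LocalLine {p : ℕ} (p-prime : Prime p) (a b c d e f y₁ y₂ y₃ t : ℤ)
  (square : + p ∣ℤ t * t + Z.adjForm a b c d e f y₁ y₂ y₃)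
  (y≢0 : NotAll (+ p ∣ℤ_) y₁ y₂ y₃) where

  private
    P : ℤ
    P = + p
    Q : ℤ → ℤ → ℤ → ℤ
    Q = Z.form a b c d e f
    B : ℤ → ℤ → ℤ → ℤ → ℤ → ℤ → ℤ
    B = Z.polar a b c d e f

  Parallel : ℤ → ℤ → ℤ → ℤ → ℤ → ℤ → Set
  Parallel v₁ v₂ v₃ x₁ x₂ x₃ =
    P ∣ℤ Z.cross₁ v₁ v₂ v₃ x₁ x₂ x₃ × P ∣ℤ Z.cross₂ v₁ v₂ v₃ x₁ x₂ x₃ × P ∣ℤ Z.cross₃ v₁ v₂ v₃ x₁ x₂ x₃

  polar-divisible : ∀ {u₁ u₂ u₃} w₁ w₂ w₃ → P ∣ℤ u₁ → P ∣ℤ u₂ → P ∣ℤ u₃ → P ∣ℤ B u₁ u₂ u₃ w₁ w₂ w₃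
  polar-divisible w₁ w₂ w₃ p∣u₁ p∣u₂ p∣u₃ = ∣-by (sym (polar-as-product a b c d e f _ _ _ w₁ w₂ w₃))
    (∣m∣n⇒∣m+n (∣m∣n⇒∣m+n (∣m⇒∣m*n _ p∣u₁) (∣m⇒∣m*n _ p∣u₂)) (∣m⇒∣m*n _ p∣u₃))

  parallel-isotropic : ∀ v₁ v₂ v₃ x₁ x₂ x₃ → P ∣ℤ Q v₁ v₂ v₃ → NotAll (P ∣ℤ_) v₁ v₂ v₃ →
                       Parallel v₁ v₂ v₃ x₁ x₂ x₃ → P ∣ℤ Q x₁ x₂ x₃
  parallel-isotropic v₁ v₂ v₃ x₁ x₂ x₃ p∣Qv v≢0 (h₁ , h₂ , h₃) with P ∣? v₁ | P ∣? v₂ | P ∣? v₃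
  ... | no p∤v₁ | _ | _ = cancel-square p-prime p∤v₁ (∣-by (sym (form-times-square₁ a b c d e f v₁ v₂ v₃ x₁ x₂ x₃))
        (∣m∣n⇒∣m+n (polar-divisible _ _ _ ∣-zero h₃ (∣m⇒∣-m h₂)) (∣n⇒∣m*n (x₁ * x₁) p∣Qv)))
  ... | yes _ | no p∤v₂ | _ = cancel-square p-prime p∤v₂ (∣-by (sym (form-times-square₂ a b c d e f v₁ v₂ v₃ x₁ x₂ x₃))
        (∣m∣n⇒∣m+n (polar-divisible _ _ _ (∣m⇒∣-m h₃) ∣-zero h₁) (∣n⇒∣m*n (x₂ * x₂) p∣Qv)))
  ... | yes _ | yes _ | no p∤v₃ = cancel-square p-prime p∤v₃ (∣-by (sym (form-times-square₃ a b c d e f v₁ v₂ v₃ x₁ x₂ x₃))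
        (∣m∣n⇒∣m+n (polar-divisible _ _ _ h₂ (∣m⇒∣-m h₁) ∣-zero) (∣n⇒∣m*n (x₃ * x₃) p∣Qv)))
  ... | yes p∣v₁ | yes p∣v₂ | yes p∣v₃ = ⊥-elim (v≢0 p∣v₁ p∣v₂ p∣v₃)

  two-planes-meet-in-line : ∀ v₁ v₂ v₃ e₁ e₂ e₃ x₁ x₂ x₃ → Z.dot y₁ y₂ y₃ v₁ v₂ v₃ ≡ 0ℤ →
    ¬ (P ∣ℤ Z.dot y₁ y₂ y₃ e₁ e₂ e₃) → P ∣ℤ Z.dot y₁ y₂ y₃ x₁ x₂ x₃ →
    P ∣ℤ Z.dot (Z.cross₁ v₁ v₂ v₃ e₁ e₂ e₃) (Z.cross₂ v₁ v₂ v₃ e₁ e₂ e₃) (Z.cross₃ v₁ v₂ v₃ e₁ e₂ e₃) x₁ x₂ x₃ →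
    Parallel v₁ v₂ v₃ x₁ x₂ x₃
  two-planes-meet-in-line v₁ v₂ v₃ e₁ e₂ e₃ x₁ x₂ x₃ v⊥y p∤y·e p∣y·x p∣ℓ·x =
      coordinate (Z.cross₁ v₁ v₂ v₃ x₁ x₂ x₃) (Z.cross₁ v₁ v₂ v₃ e₁ e₂ e₃) y₁ (Z.cross₁ e₁ e₂ e₃ x₁ x₂ x₃)
          (cross-decomposition₁ v₁ v₂ v₃ e₁ e₂ e₃ x₁ x₂ x₃ y₁ y₂ y₃)
    , coordinate (Z.cross₂ v₁ v₂ v₃ x₁ x₂ x₃) (Z.cross₂ v₁ v₂ v₃ e₁ e₂ e₃) y₂ (Z.cross₂ e₁ e₂ e₃ x₁ x₂ x₃)
          (cross-decomposition₂ v₁ v₂ v₃ e₁ e₂ e₃ x₁ x₂ x₃ y₁ y₂ y₃)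
    , coordinate (Z.cross₃ v₁ v₂ v₃ x₁ x₂ x₃) (Z.cross₃ v₁ v₂ v₃ e₁ e₂ e₃) y₃ (Z.cross₃ e₁ e₂ e₃ x₁ x₂ x₃)
          (cross-decomposition₃ v₁ v₂ v₃ e₁ e₂ e₃ x₁ x₂ x₃ y₁ y₂ y₃)
    where
    p∣y·v : P ∣ℤ Z.dot y₁ y₂ y₃ v₁ v₂ v₃
    p∣y·v = ∣-by (sym v⊥y) ∣-zero
    coordinate : ∀ c ℓᵢ yᵢ eᵢ → Z.dot y₁ y₂ y₃ e₁ e₂ e₃ * c ≡ ℓᵢ * Z.dot y₁ y₂ y₃ x₁ x₂ x₃
                 - yᵢ * Z.dot (Z.cross₁ v₁ v₂ v₃ e₁ e₂ e₃) (Z.cross₂ v₁ v₂ v₃ e₁ e₂ e₃) (Z.cross₃ v₁ v₂ v₃ e₁ e₂ e₃) x₁ x₂ x₃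
                 + Z.dot y₁ y₂ y₃ v₁ v₂ v₃ * eᵢ → P ∣ℤ c
    coordinate c ℓᵢ yᵢ eᵢ eq = cancel-factor p-prime p∤y·e (∣-by (sym eq)
      (∣m∣n⇒∣m+n (∣m∣n⇒∣m-n (∣n⇒∣m*n ℓᵢ p∣y·x) (∣n⇒∣m*n yᵢ p∣ℓ·x)) (∣m⇒∣m*n eᵢ p∣y·v)))

  record IsotropicInPlane : Set where
    constructor isotropicInPlane
    field
      v₁ v₂ v₃ : ℤ
      v⊥y : Z.dot y₁ y₂ y₃ v₁ v₂ v₃ ≡ 0ℤ
      v-isotropic : P ∣ℤ Q v₁ v₂ v₃
      v≢0 : NotAll (P ∣ℤ_) v₁ v₂ v₃

  ¬scaled-y : ∀ {s} → ¬ (P ∣ℤ s) → NotAll (P ∣ℤ_) (y₁ * s) (y₂ * s) (y₃ * s)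
  ¬scaled-y {s} p∤s h₁ h₂ h₃ = y≢0 (cancel-factor p-prime p∤s (∣-by (*-comm y₁ s) h₁))
    (cancel-factor p-prime p∤s (∣-by (*-comm y₂ s) h₂)) (cancel-factor p-prime p∤s (∣-by (*-comm y₃ s) h₃))

  ¬divisible-of-cross : ∀ {u₁ u₂ u₃ w₁ w₂ w₃ s} → ¬ (P ∣ℤ s) →
    Z.cross₁ u₁ u₂ u₃ w₁ w₂ w₃ ≡ y₁ * s → Z.cross₂ u₁ u₂ u₃ w₁ w₂ w₃ ≡ y₂ * s → Z.cross₃ u₁ u₂ u₃ w₁ w₂ w₃ ≡ y₃ * s →
    NotAll (P ∣ℤ_) u₁ u₂ u₃
  ¬divisible-of-cross {w₁ = w₁} {w₂} {w₃} p∤s c₁ c₂ c₃ h₁ h₂ h₃ = ¬scaled-y p∤s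
    (∣-by c₁ (∣m∣n⇒∣m-n (∣m⇒∣m*n w₃ h₂) (∣m⇒∣m*n w₂ h₃)))
    (∣-by c₂ (∣m∣n⇒∣m-n (∣m⇒∣m*n w₁ h₃) (∣m⇒∣m*n w₃ h₁)))
    (∣-by c₃ (∣m∣n⇒∣m-n (∣m⇒∣m*n w₂ h₁) (∣m⇒∣m*n w₁ h₂)))

  -- In a plane basis u, w of y^⊥: either u is isotropic, or (with A = Q(u),
  -- B = uᵀMw) v = (st − B) u + A w is, since Q(v) = A s² (t² + yᵀadj(M)y) by the
  -- Gram identity Q(u)Q(w) − B² = adj(u × w) = s² adj(y).
  isotropic-in-plane : (basis : PlaneBasis y₁ y₂ y₃) → ¬ (P ∣ℤ PlaneBasis.s basis) → IsotropicInPlane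
  isotropic-in-plane (planeBasis u₁ u₂ u₃ w₁ w₂ w₃ s u⊥y w⊥y c₁ c₂ c₃) p∤s with P ∣? Q u₁ u₂ u₃
  ... | yes p∣Qu = isotropicInPlane u₁ u₂ u₃ u⊥y p∣Qu (¬divisible-of-cross p∤s c₁ c₂ c₃)
  ... | no p∤Qu = isotropicInPlane (α * u₁ + β * w₁) (α * u₂ + β * w₂) (α * u₃ + β * w₃) v⊥y v-isotropic v≢0
    where
    A = Q u₁ u₂ u₃
    C = Q w₁ w₂ w₃
    Buw = B u₁ u₂ u₃ w₁ w₂ w₃
    adjY = Z.adjForm a b c d e f y₁ y₂ y₃
    α = s * t - Buw
    β = A
    gram : A * C - Buw * Buw ≡ s * s * adjY
    gram = begin
      A * C - Buw * Buw ≡⟨ gram-adjugate a b c d e f u₁ u₂ u₃ w₁ w₂ w₃ ⟩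
      Z.adjForm a b c d e f (Z.cross₁ u₁ u₂ u₃ w₁ w₂ w₃) (Z.cross₂ u₁ u₂ u₃ w₁ w₂ w₃) (Z.cross₃ u₁ u₂ u₃ w₁ w₂ w₃)
        ≡⟨ cong₂ (λ z₁ z₂ → Z.adjForm a b c d e f z₁ z₂ _) c₁ c₂ ⟩
      Z.adjForm a b c d e f (y₁ * s) (y₂ * s) (Z.cross₃ u₁ u₂ u₃ w₁ w₂ w₃)
        ≡⟨ cong (Z.adjForm a b c d e f (y₁ * s) (y₂ * s)) c₃ ⟩
      Z.adjForm a b c d e f (y₁ * s) (y₂ * s) (y₃ * s) ≡⟨ adjForm-scale a b c d e f y₁ y₂ y₃ s ⟩
      s * s * adjY ∎
      where open ≡-Reasoning
    value : Q (α * u₁ + β * w₁) (α * u₂ + β * w₂) (α * u₃ + β * w₃) ≡ A * (s * s) * (t * t + adjY)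
    value = begin
      Q (α * u₁ + β * w₁) (α * u₂ + β * w₂) (α * u₃ + β * w₃) ≡⟨ form-combination a b c d e f α β u₁ u₂ u₃ w₁ w₂ w₃ ⟩
      α * α * A + + 2 * α * β * Buw + β * β * C ≡⟨ complete-square A Buw C s t ⟩
      A * ((s * t) * (s * t) + (A * C - Buw * Buw)) ≡⟨ cong (λ g → A * ((s * t) * (s * t) + g)) gram ⟩
      A * ((s * t) * (s * t) + s * s * adjY) ≡⟨ factor A s t adjY ⟩
      A * (s * s) * (t * t + adjY) ∎
      where
      open ≡-Reasoning
      complete-square : ∀ A B C s t → (s * t - B) * (s * t - B) * A + + 2 * (s * t - B) * A * B + A * A * C
                        ≡ A * ((s * t) * (s * t) + (A * C - B * B))
      complete-square = solve 5 (λ A B C s t → (s :* t :- B) :* (s :* t :- B) :* A :+ con (+ 2) :* (s :* t :- B) :* A :* B :+ A :* A :* C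
                                  := A :* ((s :* t) :* (s :* t) :+ (A :* C :- B :* B))) refl
      factor : ∀ A s t X → A * ((s * t) * (s * t) + s * s * X) ≡ A * (s * s) * (t * t + X)
      factor = solve 4 (λ A s t X → A :* ((s :* t) :* (s :* t) :+ s :* s :* X) := A :* (s :* s) :* (t :* t :+ X)) refl
    v⊥y : Z.dot y₁ y₂ y₃ (α * u₁ + β * w₁) (α * u₂ + β * w₂) (α * u₃ + β * w₃) ≡ 0ℤ
    v⊥y = trans (dot-combination α β u₁ u₂ u₃ w₁ w₂ w₃ y₁ y₂ y₃)
            (trans (cong₂ (λ g h → α * g + β * h) u⊥y w⊥y) (cong₂ _+_ (*-zeroʳ α) (*-zeroʳ β)))
    v-isotropic : P ∣ℤ Q (α * u₁ + β * w₁) (α * u₂ + β * w₂) (α * u₃ + β * w₃)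
    v-isotropic = ∣-by (sym value) (∣n⇒∣m*n (A * (s * s)) square)
    v≢0 : NotAll (P ∣ℤ_) (α * u₁ + β * w₁) (α * u₂ + β * w₂) (α * u₃ + β * w₃)
    v≢0 h₁ h₂ h₃ = ¬scaled-y p∤s
      (cancel-factor p-prime p∤Qu (∣-by (trans (cross-combination₁ α β u₁ u₂ u₃ w₁ w₂ w₃) (cong (A *_) c₁))
        (∣m∣n⇒∣m-n (∣n⇒∣m*n u₂ h₃) (∣n⇒∣m*n u₃ h₂))))
      (cancel-factor p-prime p∤Qu (∣-by (trans (cross-combination₂ α β u₁ u₂ u₃ w₁ w₂ w₃) (cong (A *_) c₂))
        (∣m∣n⇒∣m-n (∣n⇒∣m*n u₃ h₁) (∣n⇒∣m*n u₁ h₃))))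
      (cancel-factor p-prime p∤Qu (∣-by (trans (cross-combination₃ α β u₁ u₂ u₃ w₁ w₂ w₃) (cong (A *_) c₃))
        (∣m∣n⇒∣m-n (∣n⇒∣m*n u₁ h₂) (∣n⇒∣m*n u₂ h₁))))

  isotropic : IsotropicInPlane
  isotropic with P ∣? y₁ | P ∣? y₂ | P ∣? y₃
  ... | no p∤y₁ | _ | _ = isotropic-in-plane (proj₁ (planeBasis₁ y₁ y₂ y₃)) (subst (λ s → ¬ (P ∣ℤ s)) (sym (proj₂ (planeBasis₁ y₁ y₂ y₃))) p∤y₁)
  ... | yes _ | no p∤y₂ | _ = isotropic-in-plane (proj₁ (planeBasis₂ y₁ y₂ y₃)) (subst (λ s → ¬ (P ∣ℤ s)) (sym (proj₂ (planeBasis₂ y₁ y₂ y₃))) p∤y₂)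
  ... | yes _ | yes _ | no p∤y₃ = isotropic-in-plane (proj₁ (planeBasis₃ y₁ y₂ y₃)) (subst (λ s → ¬ (P ∣ℤ s)) (sym (proj₂ (planeBasis₃ y₁ y₂ y₃))) p∤y₃)
  ... | yes p∣y₁ | yes p∣y₂ | yes p∣y₃ = ⊥-elim (y≢0 p∣y₁ p∣y₂ p∣y₃)

  CutsOutIsotropic : ℤ → ℤ → ℤ → Set
  CutsOutIsotropic ℓ₁ ℓ₂ ℓ₃ = ∀ x₁ x₂ x₃ → P ∣ℤ Z.dot y₁ y₂ y₃ x₁ x₂ x₃ → P ∣ℤ Z.dot ℓ₁ ℓ₂ ℓ₃ x₁ x₂ x₃ → P ∣ℤ Q x₁ x₂ x₃

  along : ∀ e₁ e₂ e₃ → ¬ (P ∣ℤ Z.dot y₁ y₂ y₃ e₁ e₂ e₃) → Σ ℤ λ ℓ₁ → Σ ℤ λ ℓ₂ → Σ ℤ λ ℓ₃ → CutsOutIsotropic ℓ₁ ℓ₂ ℓ₃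
  along e₁ e₂ e₃ p∤y·e = let open IsotropicInPlane isotropic in
      Z.cross₁ v₁ v₂ v₃ e₁ e₂ e₃ , Z.cross₂ v₁ v₂ v₃ e₁ e₂ e₃ , Z.cross₃ v₁ v₂ v₃ e₁ e₂ e₃
    , λ x₁ x₂ x₃ p∣y·x p∣ℓ·x → parallel-isotropic v₁ v₂ v₃ x₁ x₂ x₃ v-isotropic v≢0
        (two-planes-meet-in-line v₁ v₂ v₃ e₁ e₂ e₃ x₁ x₂ x₃ v⊥y p∤y·e p∣y·x p∣ℓ·x)

  isotropic-line : Σ ℤ λ ℓ₁ → Σ ℤ λ ℓ₂ → Σ ℤ λ ℓ₃ → CutsOutIsotropic ℓ₁ ℓ₂ ℓ₃
  isotropic-line with P ∣? y₁ | P ∣? y₂ | P ∣? y₃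
  ... | no p∤y₁ | _ | _ = along 1ℤ 0ℤ 0ℤ (λ h → p∤y₁ (∣-by (solve 3 (λ y₁ y₂ y₃ → Syn.dot y₁ y₂ y₃ (con 1ℤ) (con 0ℤ) (con 0ℤ) := y₁) refl y₁ y₂ y₃) h))
  ... | yes _ | no p∤y₂ | _ = along 0ℤ 1ℤ 0ℤ (λ h → p∤y₂ (∣-by (solve 3 (λ y₁ y₂ y₃ → Syn.dot y₁ y₂ y₃ (con 0ℤ) (con 1ℤ) (con 0ℤ) := y₂) refl y₁ y₂ y₃) h))
  ... | yes _ | yes _ | no p∤y₃ = along 0ℤ 0ℤ 1ℤ (λ h → p∤y₃ (∣-by (solve 3 (λ y₁ y₂ y₃ → Syn.dot y₁ y₂ y₃ (con 0ℤ) (con 0ℤ) (con 1ℤ) := y₃) refl y₁ y₂ y₃) h))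
  ... | yes p∣y₁ | yes p∣y₂ | yes p∣y₃ = ⊥-elim (y≢0 p∣y₁ p∣y₂ p∣y₃)

residue : (p : ℕ) .{{_ : ℕ.NonZero p}} → ℤ → Fin p
residue p a = fromℕ< (n%ℕd<d a p)

residue-congruent : ∀ p .{{_ : ℕ.NonZero p}} a b → residue p a ≡ residue p b → + p ∣ℤ a - b
residue-congruent p a b same = divides (a /ℕ p - b /ℕ p) (begin
    a - b ≡⟨ cong₂ _-_ (a≡a%ℕn+[a/ℕn]*n a p) (a≡a%ℕn+[a/ℕn]*n b p) ⟩
    (+ (a %ℕ p) + (a /ℕ p) * + p) - (+ (b %ℕ p) + (b /ℕ p) * + p)
      ≡⟨ cong (λ r → (+ (a %ℕ p) + (a /ℕ p) * + p) - (+ r + (b /ℕ p) * + p)) (sym same-remainder) ⟩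
    (+ (a %ℕ p) + (a /ℕ p) * + p) - (+ (a %ℕ p) + (b /ℕ p) * + p) ≡⟨ cancel (+ (a %ℕ p)) (a /ℕ p) (b /ℕ p) (+ p) ⟩
    (a /ℕ p - b /ℕ p) * + p ∎)
  where
  open ≡-Reasoning
  same-remainder : a %ℕ p ≡ b %ℕ p
  same-remainder = trans (sym (toℕ-fromℕ< (n%ℕd<d a p))) (trans (cong toℕ same) (toℕ-fromℕ< (n%ℕd<d b p)))
  cancel : ∀ r k l m → (r + k * m) - (r + l * m) ≡ (k - l) * m
  cancel = solve 4 (λ r k l m → (r :+ k :* m) :- (r :+ l :* m) := (k :- l) :* m) refl

small-multiple≡0 : ∀ {R d} → + R ∣ℤ d → ∣ d ∣ ℕ.< R → d ≡ 0ℤ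
small-multiple≡0 {R} {d} R∣d small with ∣ d ∣ in eq
... | ℕ.zero = ∣i∣≡0⇒i≡0 eq
... | ℕ.suc k = ⊥-elim (ℕP.<⇒≱ small (ℕD.∣⇒≤ (subst (R ∣ℕ_) eq (∣⇒∣ᵤ R∣d))))

coprime-product-divides : ∀ {p m X} → Coprime p m → + p ∣ℤ X → + m ∣ℤ X → + (p ℕ.* m) ∣ℤ X
coprime-product-divides {p} {m} {X} coprime p∣X m∣X with ∣⇒∣ᵤ p∣X
... | ℕD.divides k X≡kp with coprime-divisor (coprime-sym coprime) (subst (m ∣ℕ_) (trans X≡kp (ℕP.*-comm k p)) (∣⇒∣ᵤ m∣X))
... | ℕD.divides j k≡jm = ∣ᵤ⇒∣ (ℕD.divides j (begin
      ∣ X ∣ ≡⟨ X≡kp ⟩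
      k ℕ.* p ≡⟨ cong (ℕ._* p) k≡jm ⟩
      j ℕ.* m ℕ.* p ≡⟨ ℕP.*-assoc j m p ⟩
      j ℕ.* (m ℕ.* p) ≡⟨ cong (j ℕ.*_) (ℕP.*-comm m p) ⟩
      j ℕ.* (p ℕ.* m) ∎))
  where open ≡-Reasoning

Separates : ∀ (a b c d e f y₁ y₂ y₃ : ℤ) (m : ℕ) → (ℤ → ℤ → ℤ → Fin m) → Set
Separates a b c d e f y₁ y₂ y₃ m φ = ∀ z₁ z₂ z₃ w₁ w₂ w₃ → φ z₁ z₂ z₃ ≡ φ w₁ w₂ w₃ →
  Z.dot y₁ y₂ y₃ z₁ z₂ z₃ ≡ Z.dot y₁ y₂ y₃ w₁ w₂ w₃ → + m ∣ℤ Z.form a b c d e f (z₁ - w₁) (z₂ - w₂) (z₃ - w₃)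

module Gluing (a b c d e f y₁ y₂ y₃ t : ℤ) (n : ℕ) (squarefree : SquareFree n)
  (square : + n ∣ℤ t * t + Z.adjForm a b c d e f y₁ y₂ y₃)
  (y-primitive : ∀ p → Prime p → p ∣ℕ n → NotAll (+ p ∣ℤ_) y₁ y₂ y₃) where

  separating : (ps : List ℕ) → All Prime ps → product ps ∣ℕ n →
               Σ (ℤ → ℤ → ℤ → Fin (product ps)) (Separates a b c d e f y₁ y₂ y₃ (product ps))
  separating [] _ _ = (λ _ _ _ → fzero) , λ z₁ z₂ z₃ w₁ w₂ w₃ _ _ → ∣ᵤ⇒∣ (ℕD.1∣ _)
  separating (p ∷ ps) (p-prime ∷ primes) pps∣n = φ , separates
    where
    p∣n : p ∣ℕ n
    p∣n = ℕD.∣-trans (ℕD.m∣m*n (product ps)) pps∣n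
    rest = separating ps primes (ℕD.∣-trans (ℕD.n∣m*n p) pps∣n)
    -- p is coprime to the other factors, as p² ∤ n.
    coprime : Coprime p (product ps)
    coprime {i} (i∣p , i∣ps) with prime⇒irreducible p-prime i∣p
    ... | inj₁ i≡1 = i≡1
    ... | inj₂ refl = ⊥-elim (¬prime[1] (subst Prime (squarefree i (ℕD.∣-trans (ℕD.*-monoʳ-∣ i i∣ps) pps∣n)) p-prime))
    open LocalLine p-prime a b c d e f y₁ y₂ y₃ t (∣ᵤ⇒∣ (ℕD.∣-trans p∣n (∣⇒∣ᵤ square))) (y-primitive p p-prime p∣n)
    ℓ₁ = proj₁ isotropic-line
    ℓ₂ = proj₁ (proj₂ isotropic-line)
    ℓ₃ = proj₁ (proj₂ (proj₂ isotropic-line))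
    cuts = proj₂ (proj₂ (proj₂ isotropic-line))
    instance
      p-nonZero : ℕ.NonZero p
      p-nonZero = prime⇒nonZero p-prime
    φ : ℤ → ℤ → ℤ → Fin (p ℕ.* product ps)
    φ z₁ z₂ z₃ = combine (residue p (Z.dot ℓ₁ ℓ₂ ℓ₃ z₁ z₂ z₃)) (proj₁ rest z₁ z₂ z₃)
    separates : Separates a b c d e f y₁ y₂ y₃ (p ℕ.* product ps) φ
    separates z₁ z₂ z₃ w₁ w₂ w₃ same-class same-y = coprime-product-divides coprime
      (cuts (z₁ - w₁) (z₂ - w₂) (z₃ - w₃)
        (∣-by (sym (trans (dot-sub y₁ y₂ y₃ z₁ z₂ z₃ w₁ w₂ w₃) (i≡j⇒i-j≡0 same-y))) ∣-zero)
        (∣-by (sym (dot-sub ℓ₁ ℓ₂ ℓ₃ z₁ z₂ z₃ w₁ w₂ w₃))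
          (residue-congruent p ℓ·z ℓ·w (combine-injectiveˡ (residue p ℓ·z) (class z₁ z₂ z₃) (residue p ℓ·w) (class w₁ w₂ w₃) same-class))))
      (proj₂ rest z₁ z₂ z₃ w₁ w₂ w₃ (combine-injectiveʳ (residue p ℓ·z) (class z₁ z₂ z₃) (residue p ℓ·w) (class w₁ w₂ w₃) same-class) same-y)
      where
      ℓ·z = Z.dot ℓ₁ ℓ₂ ℓ₃ z₁ z₂ z₃
      ℓ·w = Z.dot ℓ₁ ℓ₂ ℓ₃ w₁ w₂ w₃
      class = proj₁ rest

ℓ¹ : ℤ → ℤ → ℤ → ℕ
ℓ¹ y₁ y₂ y₃ = ∣ y₁ ∣ ℕ.+ ∣ y₂ ∣ ℕ.+ ∣ y₃ ∣

dot-bound : ∀ y₁ y₂ y₃ x₁ x₂ x₃ H → ∣ x₁ ∣ ℕ.≤ H → ∣ x₂ ∣ ℕ.≤ H → ∣ x₃ ∣ ℕ.≤ H →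
            ∣ Z.dot y₁ y₂ y₃ x₁ x₂ x₃ ∣ ℕ.≤ ℓ¹ y₁ y₂ y₃ ℕ.* H
dot-bound y₁ y₂ y₃ x₁ x₂ x₃ H x₁≤H x₂≤H x₃≤H = begin
  ∣ y₁ * x₁ + y₂ * x₂ + y₃ * x₃ ∣ ≤⟨ ∣i+j∣≤∣i∣+∣j∣ (y₁ * x₁ + y₂ * x₂) (y₃ * x₃) ⟩
  ∣ y₁ * x₁ + y₂ * x₂ ∣ ℕ.+ ∣ y₃ * x₃ ∣ ≤⟨ ℕP.+-monoˡ-≤ _ (∣i+j∣≤∣i∣+∣j∣ (y₁ * x₁) (y₂ * x₂)) ⟩
  ∣ y₁ * x₁ ∣ ℕ.+ ∣ y₂ * x₂ ∣ ℕ.+ ∣ y₃ * x₃ ∣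
    ≡⟨ cong₂ ℕ._+_ (cong₂ ℕ._+_ (abs-* y₁ x₁) (abs-* y₂ x₂)) (abs-* y₃ x₃) ⟩
  ∣ y₁ ∣ ℕ.* ∣ x₁ ∣ ℕ.+ ∣ y₂ ∣ ℕ.* ∣ x₂ ∣ ℕ.+ ∣ y₃ ∣ ℕ.* ∣ x₃ ∣
    ≤⟨ ℕP.+-mono-≤ (ℕP.+-mono-≤ (ℕP.*-monoʳ-≤ ∣ y₁ ∣ x₁≤H) (ℕP.*-monoʳ-≤ ∣ y₂ ∣ x₂≤H)) (ℕP.*-monoʳ-≤ ∣ y₃ ∣ x₃≤H) ⟩
  ∣ y₁ ∣ ℕ.* H ℕ.+ ∣ y₂ ∣ ℕ.* H ℕ.+ ∣ y₃ ∣ ℕ.* H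
    ≡⟨ sym (trans (ℕP.*-distribʳ-+ H (∣ y₁ ∣ ℕ.+ ∣ y₂ ∣) ∣ y₃ ∣) (cong (ℕ._+ ∣ y₃ ∣ ℕ.* H) (ℕP.*-distribʳ-+ H ∣ y₁ ∣ ∣ y₂ ∣))) ⟩
  ℓ¹ y₁ y₂ y₃ ℕ.* H ∎
  where open ℕP.≤-Reasoning

difference-bound : ∀ {H} (i j : Fin (ℕ.suc H)) → ∣ + toℕ i - + toℕ j ∣ ℕ.≤ H
difference-bound {H} i j = begin
  ∣ + toℕ i - + toℕ j ∣ ≡⟨ cong ∣_∣ ([+m]-[+n]≡m⊖n (toℕ i) (toℕ j)) ⟩
  ∣ toℕ i ⊖ toℕ j ∣ ≤⟨ ∣m⊝n∣≤m⊔n (toℕ i) (toℕ j) ⟩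
  toℕ i ℕ.⊔ toℕ j ≤⟨ ℕP.⊔-lub (toℕ≤pred[n] i) (toℕ≤pred[n] j) ⟩
  H ∎
  where open ℕP.≤-Reasoning

record Collision (m : ℕ) (φ : ℤ → ℤ → ℤ → Fin m) (y₁ y₂ y₃ : ℤ) (H : ℕ) : Set where
  constructor collision
  field
    z₁ z₂ z₃ w₁ w₂ w₃ : ℤ
    same-class : φ z₁ z₂ z₃ ≡ φ w₁ w₂ w₃
    same-y : Z.dot y₁ y₂ y₃ z₁ z₂ z₃ ≡ Z.dot y₁ y₂ y₃ w₁ w₂ w₃
    distinct : NotAll (_≡ 0ℤ) (z₁ - w₁) (z₂ - w₂) (z₃ - w₃)
    close₁ : ∣ z₁ - w₁ ∣ ℕ.≤ H
    close₂ : ∣ z₂ - w₂ ∣ ℕ.≤ H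
    close₃ : ∣ z₃ - w₃ ∣ ℕ.≤ H

-- The pigeonhole principle on the box: y·_ takes at most ℓ¹(y)·H + 1 values
-- on differences, so with m·(ℓ¹(y)·H + 1) < (H+1)³ two points collide.
box-collision : ∀ m (φ : ℤ → ℤ → ℤ → Fin m) y₁ y₂ y₃ H →
  m ℕ.* ℕ.suc (ℓ¹ y₁ y₂ y₃ ℕ.* H) ℕ.< ℕ.suc H ℕ.* (ℕ.suc H ℕ.* ℕ.suc H) → Collision m φ y₁ y₂ y₃ H
box-collision m φ y₁ y₂ y₃ H few-classes = collide (pigeonhole few-classes class)
  where
  side = ℕ.suc H
  R = ℕ.suc (ℓ¹ y₁ y₂ y₃ ℕ.* H)
  Box = Fin (side ℕ.* (side ℕ.* side))
  c₁ c₂ c₃ : Box → Fin side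
  c₁ i = proj₁ (remQuot {side} (side ℕ.* side) i)
  c₂ i = proj₁ (remQuot {side} side (proj₂ (remQuot {side} (side ℕ.* side) i)))
  c₃ i = proj₂ (remQuot {side} side (proj₂ (remQuot {side} (side ℕ.* side) i)))
  coordinates-determine : ∀ i → combine (c₁ i) (combine (c₂ i) (c₃ i)) ≡ i
  coordinates-determine i = trans (cong (combine (c₁ i)) (combine-remQuot {side} side (proj₂ (remQuot {side} (side ℕ.* side) i))))
                                  (combine-remQuot {side} (side ℕ.* side) i)
  X₁ X₂ X₃ : Box → ℤ
  X₁ i = + toℕ (c₁ i)
  X₂ i = + toℕ (c₂ i)
  X₃ i = + toℕ (c₃ i)
  y· : Box → ℤ
  y· i = Z.dot y₁ y₂ y₃ (X₁ i) (X₂ i) (X₃ i)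
  class : Box → Fin (m ℕ.* R)
  class i = combine (φ (X₁ i) (X₂ i) (X₃ i)) (residue R (y· i))
  equal-coordinate : ∀ {k l : Fin side} → + toℕ k - + toℕ l ≡ 0ℤ → k ≡ l
  equal-coordinate {k} {l} k-l≡0 = toℕ-injective (+-injective (i-j≡0⇒i≡j _ _ k-l≡0))
  collide : (Σ Box λ i → Σ Box λ j → i <ᶠ j × class i ≡ class j) → Collision m φ y₁ y₂ y₃ H
  collide (i , j , i<j , same) = collision (X₁ i) (X₂ i) (X₃ i) (X₁ j) (X₂ j) (X₃ j)
      (combine-injectiveˡ (φ (X₁ i) (X₂ i) (X₃ i)) (residue R (y· i)) (φ (X₁ j) (X₂ j) (X₃ j)) (residue R (y· j)) same)
      (i-j≡0⇒i≡j _ _ y-difference≡0)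
      (λ e₁ e₂ e₃ → <⇒≢ᶠ i<j (trans (sym (coordinates-determine i))
        (trans (cong₂ combine (equal-coordinate {c₁ i} {c₁ j} e₁)
                              (cong₂ combine (equal-coordinate {c₂ i} {c₂ j} e₂) (equal-coordinate {c₃ i} {c₃ j} e₃)))
               (coordinates-determine j))))
      (difference-bound (c₁ i) (c₁ j)) (difference-bound (c₂ i) (c₂ j)) (difference-bound (c₃ i) (c₃ j))
    where
    -- The values y·z and y·w are congruent modulo R but differ by less than R.
    y-difference≡0 : y· i - y· j ≡ 0ℤ
    y-difference≡0 = small-multiple≡0
      (residue-congruent R (y· i) (y· j)
        (combine-injectiveʳ (φ (X₁ i) (X₂ i) (X₃ i)) (residue R (y· i)) (φ (X₁ j) (X₂ j) (X₃ j)) (residue R (y· j)) same))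
      (ℕ.s≤s (subst (λ v → ∣ v ∣ ℕ.≤ ℓ¹ y₁ y₂ y₃ ℕ.* H) (dot-sub y₁ y₂ y₃ (X₁ i) (X₂ i) (X₃ i) (X₁ j) (X₂ j) (X₃ j))
        (dot-bound y₁ y₂ y₃ _ _ _ H (difference-bound (c₁ i) (c₁ j)) (difference-bound (c₂ i) (c₂ j)) (difference-bound (c₃ i) (c₃ j)))))

norm² : ℤ → ℤ → ℤ → ℕ
norm² x₁ x₂ x₃ = ∣ x₁ ∣ ℕ.* ∣ x₁ ∣ ℕ.+ ∣ x₂ ∣ ℕ.* ∣ x₂ ∣ ℕ.+ ∣ x₃ ∣ ℕ.* ∣ x₃ ∣

κ : ℕ
κ = 432

record ShortIsotropic (n : ℕ) (a b c d e f y₁ y₂ y₃ : ℤ) : Set where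
  constructor shortIsotropic
  field
    x₁ x₂ x₃ : ℤ
    x≢0 : NotAll (_≡ 0ℤ) x₁ x₂ x₃
    isotropic : + n ∣ℤ Z.form a b c d e f x₁ x₂ x₃
    short : norm² x₁ x₂ x₃ ℕ.* norm² x₁ x₂ x₃ ℕ.≤ κ ℕ.* (n ℕ.* n) ℕ.* norm² y₁ y₂ y₃

ℓ¹-positive : ∀ y₁ y₂ y₃ → NotAll (_≡ 0ℤ) y₁ y₂ y₃ → 1 ℕ.≤ ℓ¹ y₁ y₂ y₃
ℓ¹-positive y₁ y₂ y₃ y≢0 with ℓ¹ y₁ y₂ y₃ ℕ.≟ 0
... | no ℓ¹≢0 = ℕP.n≢0⇒n>0 ℓ¹≢0
... | yes ℓ¹≡0 = ⊥-elim (y≢0 (∣i∣≡0⇒i≡0 (ℕP.m+n≡0⇒m≡0 _ (ℕP.m+n≡0⇒m≡0 _ ℓ¹≡0)))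
                              (∣i∣≡0⇒i≡0 (ℕP.m+n≡0⇒n≡0 ∣ y₁ ∣ (ℕP.m+n≡0⇒m≡0 _ ℓ¹≡0)))
                              (∣i∣≡0⇒i≡0 (ℕP.m+n≡0⇒n≡0 (∣ y₁ ∣ ℕ.+ ∣ y₂ ∣) ℓ¹≡0)))

norm²-in-box : ∀ {x₁ x₂ x₃ H} → ∣ x₁ ∣ ℕ.≤ H → ∣ x₂ ∣ ℕ.≤ H → ∣ x₃ ∣ ℕ.≤ H → norm² x₁ x₂ x₃ ℕ.≤ 3 ℕ.* (H ℕ.* H)
norm²-in-box {H = H} x₁≤H x₂≤H x₃≤H = ℕP.≤-trans
  (ℕP.+-mono-≤ (ℕP.+-mono-≤ (ℕP.*-mono-≤ x₁≤H x₁≤H) (ℕP.*-mono-≤ x₂≤H x₂≤H)) (ℕP.*-mono-≤ x₃≤H x₃≤H))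
  (ℕP.≤-reflexive (three-times H))
  where
  three-times : ∀ k → k ℕ.* k ℕ.+ k ℕ.* k ℕ.+ k ℕ.* k ≡ 3 ℕ.* (k ℕ.* k)
  three-times = solve-∀

-- The counting argument: a classifier with m classes separating Q along y ≠ 0
-- yields a short isotropic vector modulo m, namely the difference of a
-- collision in the box of side H ≈ √(m ℓ¹(y)).
short-from-separating : ∀ m a b c d e f y₁ y₂ y₃ (φ : ℤ → ℤ → ℤ → Fin m) →
  Separates a b c d e f y₁ y₂ y₃ m φ → NotAll (_≡ 0ℤ) y₁ y₂ y₃ → ShortIsotropic m a b c d e f y₁ y₂ y₃
short-from-separating m a b c d e f y₁ y₂ y₃ φ separates y≢0 = sized (NatBounds.approxSqrt (m ℕ.* s))
  where
  s = ℓ¹ y₁ y₂ y₃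
  from-collision : ∀ H → H ℕ.* H ℕ.≤ 4 ℕ.* (m ℕ.* s) → Collision m φ y₁ y₂ y₃ H → ShortIsotropic m a b c d e f y₁ y₂ y₃
  from-collision H H²≤4ms (collision z₁ z₂ z₃ w₁ w₂ w₃ same-class same-y distinct close₁ close₂ close₃) =
    shortIsotropic (z₁ - w₁) (z₂ - w₂) (z₃ - w₃) distinct (separates z₁ z₂ z₃ w₁ w₂ w₃ same-class same-y)
      (NatBounds.boxVector-bound m s H (norm² y₁ y₂ y₃) (norm² (z₁ - w₁) (z₂ - w₂) (z₃ - w₃)) H²≤4ms
        (NatBounds.square-sum≤3·sum-squares (∣ y₁ ∣) (∣ y₂ ∣) (∣ y₃ ∣)) (norm²-in-box {z₁ - w₁} {z₂ - w₂} {z₃ - w₃} close₁ close₂ close₃))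
  sized : (Σ ℕ λ H → m ℕ.* s ℕ.≤ H ℕ.* H × H ℕ.* H ℕ.≤ 4 ℕ.* (m ℕ.* s)) → ShortIsotropic m a b c d e f y₁ y₂ y₃
  sized (H , ms≤H² , H²≤4ms) =
    from-collision H H²≤4ms (box-collision m φ y₁ y₂ y₃ H (NatBounds.boxOutnumbers m s H (ℓ¹-positive y₁ y₂ y₃ y≢0) ms≤H²))

inverse-mod : ∀ g n' → Coprime g n' → Σ ℤ λ e → + n' ∣ℤ e * + g - 1ℤ
inverse-mod g n' coprime with coprime-Bézout coprime
... | Bézout.+- x y 1+yn'≡xg = + x , divides (+ y) (begin
      + x * + g - 1ℤ ≡⟨ cong (_- 1ℤ) (sym (pos-* x g)) ⟩
      + (x ℕ.* g) - 1ℤ ≡⟨ cong (λ k → + k - 1ℤ) (sym 1+yn'≡xg) ⟩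
      + (1 ℕ.+ y ℕ.* n') - 1ℤ ≡⟨ cong (_- 1ℤ) (trans (pos-+ 1 (y ℕ.* n')) (cong (λ k → 1ℤ + k) (pos-* y n'))) ⟩
      (1ℤ + + y * + n') - 1ℤ ≡⟨ solve 1 (λ k → (con 1ℤ :+ k) :- con 1ℤ := k) refl (+ y * + n') ⟩
      + y * + n' ∎)
  where open ≡-Reasoning
... | Bézout.-+ x y 1+xg≡yn' = - + x , divides (- + y) (begin
      - + x * + g - 1ℤ ≡⟨ cong (_- 1ℤ) (sym (neg-distribˡ-* (+ x) (+ g))) ⟩
      - (+ x * + g) - 1ℤ ≡⟨ solve 1 (λ k → :- k :- con 1ℤ := :- (con 1ℤ :+ k)) refl (+ x * + g) ⟩
      - (1ℤ + + x * + g) ≡⟨ cong (λ k → - (1ℤ + k)) (sym (pos-* x g)) ⟩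
      - (1ℤ + + (x ℕ.* g)) ≡⟨ cong -_ (sym (pos-+ 1 (x ℕ.* g))) ⟩
      - + (1 ℕ.+ x ℕ.* g) ≡⟨ cong (λ k → - + k) 1+xg≡yn' ⟩
      - + (y ℕ.* n') ≡⟨ cong -_ (pos-* y n') ⟩
      - (+ y * + n') ≡⟨ neg-distribˡ-* (+ y) (+ n') ⟩
      - + y * + n' ∎)
  where open ≡-Reasoning

-- Removing a factor g from y: if n' ∣ t² + adj(g q) and e g ≡ 1 (mod n'), then
-- n' ∣ (e t)² + adj(q), since adj(g q) = g² adj(q).
square-after-division : ∀ a b c d e f q₁ q₂ q₃ g ε t n' → + n' ∣ℤ ε * g - 1ℤ →
  + n' ∣ℤ t * t + Z.adjForm a b c d e f (q₁ * g) (q₂ * g) (q₃ * g) →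
  + n' ∣ℤ (ε * t) * (ε * t) + Z.adjForm a b c d e f q₁ q₂ q₃
square-after-division a b c d e f q₁ q₂ q₃ g ε t n' εg≡1 square =
  ∣-by (sym (rearrange ε t g A))
    (∣m∣n⇒∣m-n (∣n⇒∣m*n (ε * ε) (∣-by (cong (λ k → t * t + k) (adjForm-scale a b c d e f q₁ q₂ q₃ g)) square))
               (∣m⇒∣m*n A (∣m⇒∣m*n (ε * g + 1ℤ) εg≡1)))
  where
  A = Z.adjForm a b c d e f q₁ q₂ q₃
  rearrange : ∀ ε t g A → (ε * t) * (ε * t) + A ≡ ε * ε * (t * t + g * g * A) - (ε * g - 1ℤ) * (ε * g + 1ℤ) * A
  rearrange = solve 4 (λ ε t g A → (ε :* t) :* (ε :* t) :+ A := ε :* ε :* (t :* t :+ g :* g :* A) :- (ε :* g :- con 1ℤ) :* (ε :* g :+ con 1ℤ) :* A) refl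

scale-short : ∀ g n' a b c d e f q₁ q₂ q₃ → g ≢ 0 → ShortIsotropic n' a b c d e f q₁ q₂ q₃ →
  ShortIsotropic (n' ℕ.* g) a b c d e f (q₁ * + g) (q₂ * + g) (q₃ * + g)
scale-short g n' a b c d e f q₁ q₂ q₃ g≢0 (shortIsotropic x₁ x₂ x₃ x≢0 isotropic short) =
  shortIsotropic (x₁ * G) (x₂ * G) (x₃ * G)
    (λ h₁ h₂ h₃ → x≢0 (cancel h₁) (cancel h₂) (cancel h₃))
    (∣-by (sym (form-scale a b c d e f x₁ x₂ x₃ G))
      (subst (_∣ℤ G * G * Z.form a b c d e f x₁ x₂ x₃) (trans (*-comm G (+ n')) (sym (pos-* n' g)))
        (∣-by (sym (*-assoc G G _)) (*-monoʳ-∣ G (∣n⇒∣m*n G isotropic)))))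
    (begin
      norm² (x₁ * G) (x₂ * G) (x₃ * G) ℕ.* norm² (x₁ * G) (x₂ * G) (x₃ * G)
        ≡⟨ cong (λ k → k ℕ.* k) (norm²-scale x₁ x₂ x₃) ⟩
      g ℕ.* g ℕ.* X ℕ.* (g ℕ.* g ℕ.* X) ≡⟨ regroup g X ⟩
      g ℕ.* g ℕ.* (g ℕ.* g) ℕ.* (X ℕ.* X) ≤⟨ ℕP.*-monoʳ-≤ (g ℕ.* g ℕ.* (g ℕ.* g)) short ⟩
      g ℕ.* g ℕ.* (g ℕ.* g) ℕ.* (κ ℕ.* (n' ℕ.* n') ℕ.* Y) ≡⟨ regroup′ κ g n' Y ⟩
      κ ℕ.* (n' ℕ.* g ℕ.* (n' ℕ.* g)) ℕ.* (g ℕ.* g ℕ.* Y) ≡⟨ cong (κ ℕ.* (n' ℕ.* g ℕ.* (n' ℕ.* g)) ℕ.*_) (sym (norm²-scale q₁ q₂ q₃)) ⟩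
      κ ℕ.* (n' ℕ.* g ℕ.* (n' ℕ.* g)) ℕ.* norm² (q₁ * G) (q₂ * G) (q₃ * G) ∎)
  where
  open ℕP.≤-Reasoning
  G = + g
  X = norm² x₁ x₂ x₃
  Y = norm² q₁ q₂ q₃
  cancel : ∀ {u} → u * G ≡ 0ℤ → u ≡ 0ℤ
  cancel {u} uG≡0 with i*j≡0⇒i≡0∨j≡0 u uG≡0
  ... | inj₁ u≡0 = u≡0
  ... | inj₂ G≡0 = ⊥-elim (g≢0 (+-injective G≡0))
  norm²-scale : ∀ u₁ u₂ u₃ → norm² (u₁ * G) (u₂ * G) (u₃ * G) ≡ g ℕ.* g ℕ.* norm² u₁ u₂ u₃
  norm²-scale u₁ u₂ u₃ = trans (cong₂ ℕ._+_ (cong₂ ℕ._+_ (cong (λ k → k ℕ.* k) (abs-* u₁ G)) (cong (λ k → k ℕ.* k) (abs-* u₂ G)))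
                                             (cong (λ k → k ℕ.* k) (abs-* u₃ G)))
                               (factor (∣ u₁ ∣) (∣ u₂ ∣) (∣ u₃ ∣) g)
    where
    factor : ∀ a b c g → a ℕ.* g ℕ.* (a ℕ.* g) ℕ.+ b ℕ.* g ℕ.* (b ℕ.* g) ℕ.+ c ℕ.* g ℕ.* (c ℕ.* g) ≡ g ℕ.* g ℕ.* (a ℕ.* a ℕ.+ b ℕ.* b ℕ.+ c ℕ.* c)
    factor = solve-∀
  regroup : ∀ g X → g ℕ.* g ℕ.* X ℕ.* (g ℕ.* g ℕ.* X) ≡ g ℕ.* g ℕ.* (g ℕ.* g) ℕ.* (X ℕ.* X)
  regroup = solve-∀
  regroup′ : ∀ K g n Y → g ℕ.* g ℕ.* (g ℕ.* g) ℕ.* (K ℕ.* (n ℕ.* n) ℕ.* Y) ≡ K ℕ.* (n ℕ.* g ℕ.* (n ℕ.* g)) ℕ.* (g ℕ.* g ℕ.* Y)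
  regroup′ = solve-∀

ShortIsotropicExists : ℕ → Set
ShortIsotropicExists n = SquareFree n → n ≢ 0 → ∀ a b c d e f y₁ y₂ y₃ t → NotAll (_≡ 0ℤ) y₁ y₂ y₃ →
  + n ∣ℤ t * t + Z.adjForm a b c d e f y₁ y₂ y₃ → ShortIsotropic n a b c d e f y₁ y₂ y₃

short-isotropic-primitive : ∀ n → SquareFree n → n ≢ 0 → ∀ a b c d e f y₁ y₂ y₃ t → NotAll (_≡ 0ℤ) y₁ y₂ y₃ →
  + n ∣ℤ t * t + Z.adjForm a b c d e f y₁ y₂ y₃ → (∀ p → Prime p → p ∣ℕ n → NotAll (+ p ∣ℤ_) y₁ y₂ y₃) →
  ShortIsotropic n a b c d e f y₁ y₂ y₃
short-isotropic-primitive n squarefree n≢0 a b c d e f y₁ y₂ y₃ t y≢0 square y-primitive =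
  subst (λ m → ShortIsotropic m a b c d e f y₁ y₂ y₃) (sym n≡∏ps)
    (short-from-separating (product ps) a b c d e f y₁ y₂ y₃ (proj₁ glued) (proj₂ glued) y≢0)
  where
  instance
    n-nonZero : ℕ.NonZero n
    n-nonZero = ℕ.≢-nonZero n≢0
  open PrimeFactorisation (factorise n) renaming (factors to ps; isFactorisation to n≡∏ps)
  glued = Gluing.separating a b c d e f y₁ y₂ y₃ t n squarefree square y-primitive ps factorsPrime (ℕD.∣-reflexive (sym n≡∏ps))

-- Writing
-- n = n' g, the factor g is coprime to n' (n is square-free); replace t by
-- g⁻¹ t modulo n', solve for (n', q) by induction, and scale by g.
short-isotropic-common-factor : ∀ n g → (∀ {m} → m ℕ.< n → ShortIsotropicExists m) → 1 ℕ.< g → g ∣ℕ n →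
  SquareFree n → n ≢ 0 → ∀ a b c d e f y₁ y₂ y₃ t → + g ∣ℤ y₁ → + g ∣ℤ y₂ → + g ∣ℤ y₃ → NotAll (_≡ 0ℤ) y₁ y₂ y₃ →
  + n ∣ℤ t * t + Z.adjForm a b c d e f y₁ y₂ y₃ → ShortIsotropic n a b c d e f y₁ y₂ y₃
short-isotropic-common-factor _ g smaller 1<g (ℕD.divides n' refl) squarefree n≢0 a b c d e f _ _ _ t
  (divides q₁ refl) (divides q₂ refl) (divides q₃ refl) y≢0 square =
  scale-short g n' a b c d e f q₁ q₂ q₃ g≢0
    (smaller n'<n squarefree' n'≢0 a b c d e f q₁ q₂ q₃ (ε * t) q≢0
      (square-after-division a b c d e f q₁ q₂ q₃ (+ g) ε t n' εg≡1
        (∣ᵤ⇒∣ (ℕD.∣-trans (ℕD.m∣m*n g) (∣⇒∣ᵤ square)))))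
  where
  g≢0 : g ≢ 0
  g≢0 refl = ℕP.<-asym 1<g ℕ.z<s
  n'≢0 : n' ≢ 0
  n'≢0 refl = n≢0 refl
  n'<n : n' ℕ.< n' ℕ.* g
  n'<n = ℕP.m<m*n n' g {{ℕ.≢-nonZero n'≢0}} 1<g
  squarefree' : SquareFree n'
  squarefree' d d²∣n' = squarefree d (ℕD.∣-trans d²∣n' (ℕD.m∣m*n g))
  coprime : Coprime g n'
  coprime {i} (i∣g , i∣n') = squarefree i (ℕD.*-pres-∣ i∣n' i∣g)
  ε = proj₁ (inverse-mod g n' coprime)
  εg≡1 = proj₂ (inverse-mod g n' coprime)
  q≢0 : NotAll (_≡ 0ℤ) q₁ q₂ q₃
  q≢0 q₁≡0 q₂≡0 q₃≡0 = y≢0 (cong (_* + g) q₁≡0) (cong (_* + g) q₂≡0) (cong (_* + g) q₃≡0)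

≢0,1⇒>1 : ∀ g → g ≢ 0 → g ≢ 1 → 1 ℕ.< g
≢0,1⇒>1 0 g≢0 _ = ⊥-elim (g≢0 refl)
≢0,1⇒>1 1 _ g≢1 = ⊥-elim (g≢1 refl)
≢0,1⇒>1 (ℕ.suc (ℕ.suc _)) _ _ = ℕ.s≤s (ℕ.s≤s ℕ.z≤n)

content : ℤ → ℤ → ℤ → ℕ
content y₁ y₂ y₃ = gcd ∣ y₁ ∣ (gcd ∣ y₂ ∣ ∣ y₃ ∣)

short-isotropic : ∀ n → ShortIsotropicExists n
short-isotropic = <-rec ShortIsotropicExists step
  where
  step : ∀ n → (∀ {m} → m ℕ.< n → ShortIsotropicExists m) → ShortIsotropicExists n
  step n smaller squarefree n≢0 a b c d e f y₁ y₂ y₃ t y≢0 square with gcd n (content y₁ y₂ y₃) ℕ.≟ 1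
  ... | yes coprime = short-isotropic-primitive n squarefree n≢0 a b c d e f y₁ y₂ y₃ t y≢0 square y-primitive
    where
    y-primitive : ∀ p → Prime p → p ∣ℕ n → NotAll (+ p ∣ℤ_) y₁ y₂ y₃
    y-primitive p p-prime p∣n p∣y₁ p∣y₂ p∣y₃ = ¬prime[1] (subst Prime (ℕD.∣1⇒≡1 (subst (p ∣ℕ_) coprime
      (gcd-greatest p∣n (gcd-greatest (∣⇒∣ᵤ p∣y₁) (gcd-greatest (∣⇒∣ᵤ p∣y₂) (∣⇒∣ᵤ p∣y₃)))))) p-prime)
  ... | no g≢1 = short-isotropic-common-factor n g smaller 1<g (gcd[m,n]∣m n C) squarefree n≢0 a b c d e f y₁ y₂ y₃ t
                   (∣ᵤ⇒∣ (ℕD.∣-trans (gcd[m,n]∣n n C) (gcd[m,n]∣m ∣ y₁ ∣ _)))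
                   (∣ᵤ⇒∣ (ℕD.∣-trans (gcd[m,n]∣n n C) (ℕD.∣-trans (gcd[m,n]∣n ∣ y₁ ∣ _) (gcd[m,n]∣m ∣ y₂ ∣ ∣ y₃ ∣))))
                   (∣ᵤ⇒∣ (ℕD.∣-trans (gcd[m,n]∣n n C) (ℕD.∣-trans (gcd[m,n]∣n ∣ y₁ ∣ _) (gcd[m,n]∣n ∣ y₂ ∣ ∣ y₃ ∣))))
                   y≢0 square
    where
    C = content y₁ y₂ y₃
    g = gcd n C
    1<g : 1 ℕ.< g
    1<g = ≢0,1⇒>1 g (gcd[m,n]≢0 n C (inj₁ n≢0)) g≢1

module FormMatrix (q : ℕ) (Q : Ternary) where
  open Ternary Q public

  h : ℤ
  h = + (ℕ.suc q ℕ./ 2)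

  a b c d e f : ℤ
  a = a11
  b = a22
  c = a33
  d = a12 * h
  e = a13 * h
  f = a23 * h

  adj-matches : ∀ (y : Vec3) → QadjEval q Q y ≡ Z.adjForm a b c d e f (y fzero) (y (fsuc fzero)) (y (fsuc (fsuc fzero)))
  adj-matches y = solve 9 (λ a b c d e f y₁ y₂ y₃ → Syn.matForm′ (Syn.adjugate′ (Syn.symMatrix a b c d e f)) (Syn.vec3 y₁ y₂ y₃)
                           := Syn.adjForm a b c d e f y₁ y₂ y₃) refl a b c d e f (y fzero) (y (fsuc fzero)) (y (fsuc (fsuc fzero)))

  form-matches : ∀ x₁ x₂ x₃ → Z.form a b c d e f x₁ x₂ x₃ ≡
    evalQ Q (Z.vec3 x₁ x₂ x₃) + (+ 2 * h - 1ℤ) * (a12 * x₁ * x₂ + a13 * x₁ * x₃ + a23 * x₂ * x₃)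
  form-matches x₁ x₂ x₃ = solve 10 (λ a b c a₁₂ a₁₃ a₂₃ h x₁ x₂ x₃ → Syn.form a b c (a₁₂ :* h) (a₁₃ :* h) (a₂₃ :* h) x₁ x₂ x₃ :=
      Syn.evalQ′ a b c a₁₂ a₁₃ a₂₃ (Syn.vec3 x₁ x₂ x₃) :+ (con (+ 2) :* h :- con 1ℤ) :* (a₁₂ :* x₁ :* x₂ :+ a₁₃ :* x₁ :* x₃ :+ a₂₃ :* x₂ :* x₃))
    refl a11 a22 a33 a12 a13 a23 h x₁ x₂ x₃

twice-half : ∀ q → Odd q → + 2 * + (ℕ.suc q ℕ./ 2) - 1ℤ ≡ + q
twice-half q q-odd with q ℕ.% 2 | m≡m%n+[m/n]*n q 2 | m%n<n q 2
... | 0 | q≡2k | _ = ⊥-elim (q-odd (ℕD.divides (q ℕ./ 2) q≡2k))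
... | ℕ.suc (ℕ.suc _) | _ | ℕ.s≤s (ℕ.s≤s ())
... | 1 | q≡1+2k | _ = begin
   + 2 * + (ℕ.suc q ℕ./ 2) - 1ℤ ≡⟨ cong (λ m → + 2 * + m - 1ℤ) half-suc ⟩
   + 2 * + ℕ.suc k - 1ℤ ≡⟨ cong (λ m → + 2 * m - 1ℤ) (pos-+ 1 k) ⟩
   + 2 * (1ℤ + + k) - 1ℤ ≡⟨ solve 1 (λ k → con (+ 2) :* (con 1ℤ :+ k) :- con 1ℤ := con 1ℤ :+ k :* con (+ 2)) refl (+ k) ⟩
   1ℤ + + k * + 2 ≡⟨ cong (λ m → 1ℤ + m) (sym (pos-* k 2)) ⟩
   1ℤ + + (k ℕ.* 2) ≡⟨ sym (pos-+ 1 (k ℕ.* 2)) ⟩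
   + (1 ℕ.+ k ℕ.* 2) ≡⟨ cong +_ (sym q≡1+2k) ⟩
   + q ∎
  where
  open ≡-Reasoning
  k = q ℕ./ 2
  half-suc : ℕ.suc q ℕ./ 2 ≡ ℕ.suc k
  half-suc = trans (cong (λ m → ℕ.suc m ℕ./ 2) q≡1+2k) (m*n/n≡m (ℕ.suc k) 2)

odd≢0 : ∀ q → Odd q → q ≢ 0
odd≢0 q q-odd refl = q-odd (ℕD.divides 0 refl)

nonzero-coordinates : ∀ (y : Vec3) → NonZeroVec y → NotAll (_≡ 0ℤ) (y fzero) (y (fsuc fzero)) (y (fsuc (fsuc fzero)))
nonzero-coordinates y (fzero , y₁≢0) y₁≡0 _ _ = y₁≢0 y₁≡0
nonzero-coordinates y (fsuc fzero , y₂≢0) _ y₂≡0 _ = y₂≢0 y₂≡0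
nonzero-coordinates y (fsuc (fsuc fzero) , y₃≢0) _ _ y₃≡0 = y₃≢0 y₃≡0

nonzero-vector : ∀ x₁ x₂ x₃ → NotAll (_≡ 0ℤ) x₁ x₂ x₃ → NonZeroVec (Z.vec3 x₁ x₂ x₃)
nonzero-vector x₁ x₂ x₃ x≢0 with x₁ ≟ 0ℤ | x₂ ≟ 0ℤ | x₃ ≟ 0ℤ
... | no x₁≢0 | _ | _ = fzero , x₁≢0
... | yes _ | no x₂≢0 | _ = fsuc fzero , x₂≢0
... | yes _ | yes _ | no x₃≢0 = fsuc (fsuc fzero) , x₃≢0
... | yes x₁≡0 | yes x₂≡0 | yes x₃≡0 = ⊥-elim (x≢0 x₁≡0 x₂≡0 x₃≡0)

normSq-coordinates : ∀ x₁ x₂ x₃ → normSq (Z.vec3 x₁ x₂ x₃) ≡ + norm² x₁ x₂ x₃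
normSq-coordinates x₁ x₂ x₃ = trans
  (cong₂ _+_ (cong₂ _+_ (square-abs x₁) (square-abs x₂)) (square-abs x₃))
  (sym (trans (pos-+ (A ℕ.+ B) C) (cong (_+ + C) (pos-+ A B))))
  where
  A = ∣ x₁ ∣ ℕ.* ∣ x₁ ∣
  B = ∣ x₂ ∣ ℕ.* ∣ x₂ ∣
  C = ∣ x₃ ∣ ℕ.* ∣ x₃ ∣
  square-abs : ∀ u → u * u ≡ + (∣ u ∣ ℕ.* ∣ u ∣)
  square-abs (+ k) = sym (pos-* k k)
  square-abs -[1+ k ] = refl

bound-in-normSq : ∀ q x₁ x₂ x₃ (y : Vec3) →
  norm² x₁ x₂ x₃ ℕ.* norm² x₁ x₂ x₃ ℕ.≤ κ ℕ.* (q ℕ.* q) ℕ.* norm² (y fzero) (y (fsuc fzero)) (y (fsuc (fsuc fzero))) →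
  normSq (Z.vec3 x₁ x₂ x₃) * normSq (Z.vec3 x₁ x₂ x₃) ≤ + κ * (+ q * + q) * normSq y
bound-in-normSq q x₁ x₂ x₃ y bound = subst₂ _≤_ (sym lhs) (sym rhs) (+≤+ bound)
  where
  Y = norm² (y fzero) (y (fsuc fzero)) (y (fsuc (fsuc fzero)))
  lhs : normSq (Z.vec3 x₁ x₂ x₃) * normSq (Z.vec3 x₁ x₂ x₃) ≡ + (norm² x₁ x₂ x₃ ℕ.* norm² x₁ x₂ x₃)
  lhs = trans (cong₂ _*_ (normSq-coordinates x₁ x₂ x₃) (normSq-coordinates x₁ x₂ x₃)) (sym (pos-* (norm² x₁ x₂ x₃) (norm² x₁ x₂ x₃)))
  rhs : + κ * (+ q * + q) * normSq y ≡ + (κ ℕ.* (q ℕ.* q) ℕ.* Y)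
  rhs = trans (cong (+ κ * (+ q * + q) *_) (normSq-coordinates (y fzero) (y (fsuc fzero)) (y (fsuc (fsuc fzero)))))
          (sym (trans (pos-* (κ ℕ.* (q ℕ.* q)) Y) (cong (_* + Y) (trans (pos-* κ (q ℕ.* q)) (cong (+ κ *_) (pos-* q q))))))

module Isotropy (q : ℕ) (q-odd : Odd q) (Q : Ternary) where
  open FormMatrix q Q

  isotropic-vector : ∀ x₁ x₂ x₃ → NotAll (_≡ 0ℤ) x₁ x₂ x₃ → + q ∣ℤ Z.form a b c d e f x₁ x₂ x₃ →
                     IsotropicMod q (evalQ Q) (Z.vec3 x₁ x₂ x₃)
  isotropic-vector x₁ x₂ x₃ x≢0 q∣Qx = nonzero-vector x₁ x₂ x₃ x≢0 , ∣⇒∣ᵤ (∣-by (sym (+-identityʳ _)) q∣evalQ)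
    where
    mixed = a12 * x₁ * x₂ + a13 * x₁ * x₃ + a23 * x₂ * x₃
    q∣evalQ : + q ∣ℤ evalQ Q (Z.vec3 x₁ x₂ x₃)
    q∣evalQ = ∣-by (trans (cong (_- (+ 2 * h - 1ℤ) * mixed) (form-matches x₁ x₂ x₃)) (+-cancelʳ-minus _ _))
      (∣m∣n⇒∣m-n q∣Qx (∣-by (cong (_* mixed) (sym (twice-half q q-odd))) (∣m⇒∣m*n mixed ∣-refl)))
      where
      +-cancelʳ-minus : ∀ u v → u + v - v ≡ u
      +-cancelʳ-minus = solve 2 (λ u v → u :+ v :- v := u) refl

least : (P : ℕ → Set) → (∀ N → Dec (P N)) → ∀ M → P M → Σ ℕ λ N → P N × (∀ m → P m → N ℕ.≤ m)
least P P? ℕ.zero P0 = 0 , P0 , λ _ _ → ℕ.z≤n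
least P P? (ℕ.suc M) PM with P? 0
... | yes P0 = 0 , P0 , λ _ _ → ℕ.z≤n
... | no ¬P0 with least (λ m → P (ℕ.suc m)) (λ m → P? (ℕ.suc m)) M PM
...   | N , PN , minimal = ℕ.suc N , PN , below
  where
  below : ∀ m → P m → ℕ.suc N ℕ.≤ m
  below ℕ.zero P0 = ⊥-elim (¬P0 P0)
  below (ℕ.suc m) Pm = ℕ.s≤s (minimal m Pm)

bounded-search : ∀ N (R : ℤ → Set) → (∀ u → Dec (R u)) → Dec (Σ ℤ λ u → ∣ u ∣ ℕ.≤ N × R u)
bounded-search N R R? with any? {n = ℕ.suc N} (λ (i : Fin (ℕ.suc N)) → R? (+ toℕ i) ⊎-dec R? (- + toℕ i))
... | yes (i , inj₁ R+i) = yes (+ toℕ i , toℕ≤pred[n] i , R+i)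
... | yes (i , inj₂ R-i) = yes (- + toℕ i , subst (ℕ._≤ N) (sym (∣-i∣≡∣i∣ (+ toℕ i))) (toℕ≤pred[n] i) , R-i)
... | no none = no λ { (u , u≤N , Ru) → none (fromℕ< (ℕ.s≤s u≤N) , signed u Ru (fromℕ< (ℕ.s≤s u≤N)) (toℕ-fromℕ< (ℕ.s≤s u≤N))) }
  where
  signed : ∀ u → R u → (i : Fin (ℕ.suc N)) → toℕ i ≡ ∣ u ∣ → R (+ toℕ i) ⊎ R (- + toℕ i)
  signed (+ k) Ru i i≡k = inj₁ (subst (λ m → R (+ m)) (sym i≡k) Ru)
  signed -[1+ k ] Ru i i≡k = inj₂ (subst (λ m → R (- + m)) (sym i≡k) Ru)

nonzero? : ∀ x₁ x₂ x₃ → Dec (NotAll (_≡ 0ℤ) x₁ x₂ x₃)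
nonzero? x₁ x₂ x₃ with x₁ ≟ 0ℤ | x₂ ≟ 0ℤ | x₃ ≟ 0ℤ
... | no x₁≢0 | _ | _ = yes (λ x₁≡0 _ _ → x₁≢0 x₁≡0)
... | yes _ | no x₂≢0 | _ = yes (λ _ x₂≡0 _ → x₂≢0 x₂≡0)
... | yes _ | yes _ | no x₃≢0 = yes (λ _ _ x₃≡0 → x₃≢0 x₃≡0)
... | yes x₁≡0 | yes x₂≡0 | yes x₃≡0 = no (λ x≢0 → x≢0 x₁≡0 x₂≡0 x₃≡0)

coordinate≤norm² : ∀ x₁ x₂ x₃ → ∣ x₁ ∣ ℕ.≤ norm² x₁ x₂ x₃ × ∣ x₂ ∣ ℕ.≤ norm² x₁ x₂ x₃ × ∣ x₃ ∣ ℕ.≤ norm² x₁ x₂ x₃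
coordinate≤norm² x₁ x₂ x₃ =
    ℕP.≤-trans (NatBounds.m≤m*m ∣ x₁ ∣) (ℕP.≤-trans (ℕP.m≤m+n A B) (ℕP.m≤m+n (A ℕ.+ B) C))
  , ℕP.≤-trans (NatBounds.m≤m*m ∣ x₂ ∣) (ℕP.≤-trans (ℕP.m≤n+m B A) (ℕP.m≤m+n (A ℕ.+ B) C))
  , ℕP.≤-trans (NatBounds.m≤m*m ∣ x₃ ∣) (ℕP.m≤n+m C (A ℕ.+ B))
  where
  A = ∣ x₁ ∣ ℕ.* ∣ x₁ ∣
  B = ∣ x₂ ∣ ℕ.* ∣ x₂ ∣
  C = ∣ x₃ ∣ ℕ.* ∣ x₃ ∣

module MinimalVector (R : ℤ → ℤ → ℤ → Set) (R? : ∀ x₁ x₂ x₃ → Dec (R x₁ x₂ x₃)) where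

  -- Some x with R x and ‖x‖² ≤ N; the coordinate bounds make this decidable.
  WithNormBelow : ℕ → Set
  WithNormBelow N = Σ ℤ λ x₁ → ∣ x₁ ∣ ℕ.≤ N × Σ ℤ λ x₂ → ∣ x₂ ∣ ℕ.≤ N × Σ ℤ λ x₃ → ∣ x₃ ∣ ℕ.≤ N ×
                    (R x₁ x₂ x₃ × norm² x₁ x₂ x₃ ℕ.≤ N)

  decide : ∀ N → Dec (WithNormBelow N)
  decide N = bounded-search N _ λ x₁ → bounded-search N _ λ x₂ → bounded-search N _ λ x₃ →
             R? x₁ x₂ x₃ ×-dec (norm² x₁ x₂ x₃ ℕ.≤? N)

  within : ∀ y₁ y₂ y₃ → R y₁ y₂ y₃ → WithNormBelow (norm² y₁ y₂ y₃)
  within y₁ y₂ y₃ Ry = let (b₁ , b₂ , b₃) = coordinate≤norm² y₁ y₂ y₃ in y₁ , b₁ , y₂ , b₂ , y₃ , b₃ , Ry , ℕP.≤-refl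

  minimal-vector : ∀ w₁ w₂ w₃ → R w₁ w₂ w₃ →
    Σ ℤ λ x₁ → Σ ℤ λ x₂ → Σ ℤ λ x₃ → R x₁ x₂ x₃ × (∀ y₁ y₂ y₃ → R y₁ y₂ y₃ → norm² x₁ x₂ x₃ ℕ.≤ norm² y₁ y₂ y₃)
  minimal-vector w₁ w₂ w₃ Rw with least WithNormBelow decide (norm² w₁ w₂ w₃) (within w₁ w₂ w₃ Rw)
  ... | N , (x₁ , _ , x₂ , _ , x₃ , _ , Rx , x≤N) , minimal =
    x₁ , x₂ , x₃ , Rx , λ y₁ y₂ y₃ Ry → ℕP.≤-trans x≤N (minimal _ (within y₁ y₂ y₃ Ry))

module Assertions (q : ℕ) (q-odd : Odd q) (squarefree : SquareFree q) (Q : Ternary) where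
  open FormMatrix q Q
  open Isotropy q q-odd Q

  short-from-square : ∀ (y : Vec3) t → NonZeroVec y →
    + q ∣ℤ - Z.adjForm a b c d e f (y fzero) (y (fsuc fzero)) (y (fsuc (fsuc fzero))) - t * t →
    ShortIsotropic q a b c d e f (y fzero) (y (fsuc fzero)) (y (fsuc (fsuc fzero)))
  short-from-square y t y≢0 q∣−adj−t² = short-isotropic q squarefree (odd≢0 q q-odd) a b c d e f _ _ _ t
    (nonzero-coordinates y y≢0) (∣-by (negate _ (t * t)) (∣m⇒∣-m q∣−adj−t²))
    where
    negate : ∀ A T → - (- A - T) ≡ T + A
    negate = solve 2 (λ A T → :- (:- A :- T) := T :+ A) refl

  -- The first assertion: m(Q;q)⁴ ≤ κ q² ‖y‖² for every y admissible for
  -- m̂(−Q^adj;q); it does not need det(Q) to be a unit.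
  short-below-adjugate : ∀ (y : Vec3) → SquareMod q (λ v → - QadjEval q Q v) y →
    ∃[ x ] (IsotropicMod q (evalQ Q) x × (normSq x * normSq x ≤ + κ * (+ q * + q) * normSq y))
  short-below-adjugate y (y≢0 , t , square) =
    Z.vec3 x₁ x₂ x₃ , isotropic-vector x₁ x₂ x₃ x≢0 isotropic , bound-in-normSq q x₁ x₂ x₃ y short
    where
    open ShortIsotropic (short-from-square y t y≢0 (∣-by (cong (λ A → - A - t * t) (adj-matches y)) (∣ᵤ⇒∣ square)))

  -- The integral form −Q^adj: coefficients −c_ii on the diagonal and −2c_ij
  -- off it, where c_ij are the cofactors of M.
  c₁₁ c₂₂ c₃₃ c₁₂ c₁₃ c₂₃ : ℤ
  c₁₁ = b * c - f * f
  c₂₂ = a * c - e * e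
  c₃₃ = a * b - d * d
  c₁₂ = e * f - d * c
  c₁₃ = d * f - e * b
  c₂₃ = d * e - a * f

  −Qadj : Ternary
  −Qadj = ternary (- c₁₁) (- c₂₂) (- c₃₃) (- (+ 2 * c₁₂)) (- (+ 2 * c₁₃)) (- (+ 2 * c₂₃))

  −Qadj-value : ∀ (y : Vec3) → evalQ −Qadj y ≡ - Z.adjForm a b c d e f (y fzero) (y (fsuc fzero)) (y (fsuc (fsuc fzero)))
  −Qadj-value y = solve 9 (λ a b c d e f y₁ y₂ y₃ →
    Syn.evalQ′ (:- (b :* c :- f :* f)) (:- (a :* c :- e :* e)) (:- (a :* b :- d :* d)) (:- (con (+ 2) :* (e :* f :- d :* c)))
      (:- (con (+ 2) :* (d :* f :- e :* b))) (:- (con (+ 2) :* (d :* e :- a :* f))) (Syn.vec3 y₁ y₂ y₃)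
    := :- Syn.adjForm a b c d e f y₁ y₂ y₃) refl a b c d e f (y fzero) (y (fsuc fzero)) (y (fsuc (fsuc fzero)))

  D : ℤ
  D = Z.det′ (Z.symMatrix a b c d e f)

  -- The difference between the determinants of the matrices of −Q^adj with
  -- off-diagonal entries −2c_ij·h and −c_ij, divided by 2h − 1.
  halving-error : ℤ
  halving-error = (- + 2) * ((+ 2 * h) * (+ 2 * h) + + 2 * h + 1ℤ) * c₁₂ * c₁₃ * c₂₃
    - (+ 2 * h + 1ℤ) * ((- c₁₁) * c₂₃ * c₂₃ + (- c₂₂) * c₁₃ * c₁₃ + (- c₃₃) * c₁₂ * c₁₂)

  -- det(−adj M) = −det(M)², and halving the off-diagonal coefficients with h
  -- changes the determinant only by a multiple of 2h − 1 = q.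
  −Qadj-det : det3 (matQ q −Qadj) ≡ - (D * D) + + q * halving-error
  −Qadj-det = trans (halving (- c₁₁) (- c₂₂) (- c₃₃) c₁₂ c₁₃ c₂₃ h)
                    (cong₂ (λ X k → X + k * halving-error) (det-negated-adjugate a b c d e f) (twice-half q q-odd))
    where
    halving : ∀ A B C k₁₂ k₁₃ k₂₃ h →
      Z.det′ (Z.symMatrix A B C ((- (+ 2 * k₁₂)) * h) ((- (+ 2 * k₁₃)) * h) ((- (+ 2 * k₂₃)) * h)) ≡
      Z.det′ (Z.symMatrix A B C (- k₁₂) (- k₁₃) (- k₂₃)) + (+ 2 * h - 1ℤ) *
        ((- + 2) * ((+ 2 * h) * (+ 2 * h) + + 2 * h + 1ℤ) * k₁₂ * k₁₃ * k₂₃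
         - (+ 2 * h + 1ℤ) * (A * k₂₃ * k₂₃ + B * k₁₃ * k₁₃ + C * k₁₂ * k₁₂))
    halving = solve 7 (λ A B C k₁₂ k₁₃ k₂₃ h →
      Syn.det′ (Syn.symMatrix A B C ((:- (con (+ 2) :* k₁₂)) :* h) ((:- (con (+ 2) :* k₁₃)) :* h) ((:- (con (+ 2) :* k₂₃)) :* h)) :=
      Syn.det′ (Syn.symMatrix A B C (:- k₁₂) (:- k₁₃) (:- k₂₃)) :+ (con (+ 2) :* h :- con 1ℤ) :*
        ((:- con (+ 2)) :* ((con (+ 2) :* h) :* (con (+ 2) :* h) :+ con (+ 2) :* h :+ con 1ℤ) :* k₁₂ :* k₁₃ :* k₂₃
         :- (con (+ 2) :* h :+ con 1ℤ) :* (A :* k₂₃ :* k₂₃ :+ B :* k₁₃ :* k₁₃ :+ C :* k₁₂ :* k₁₂))) refl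
    det-negated-adjugate : ∀ a b c d e f →
      Z.det′ (Z.symMatrix (- (b * c - f * f)) (- (a * c - e * e)) (- (a * b - d * d)) (- (e * f - d * c)) (- (d * f - e * b)) (- (d * e - a * f)))
      ≡ - (Z.det′ (Z.symMatrix a b c d e f) * Z.det′ (Z.symMatrix a b c d e f))
    det-negated-adjugate = solve 6 (λ a b c d e f →
      Syn.det′ (Syn.symMatrix (:- (b :* c :- f :* f)) (:- (a :* c :- e :* e)) (:- (a :* b :- d :* d)) (:- (e :* f :- d :* c)) (:- (d :* f :- e :* b)) (:- (d :* e :- a :* f)))
      := :- (Syn.det′ (Syn.symMatrix a b c d e f) :* Syn.det′ (Syn.symMatrix a b c d e f))) refl

  -- Hence det(−Q^adj) is coprime to q whenever det(Q) is: a common divisor i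
  -- of det(−Q^adj) and q divides D², and i is coprime to D.
  −Qadj-det-coprime : DetCoprime q Q → DetCoprime q −Qadj
  −Qadj-det-coprime det-coprime {i} (i∣det′ , i∣q) = det-coprime (i∣D , i∣q)
    where
    i∣D² : + i ∣ℤ D * D
    i∣D² = ∣-by (trans (cong (λ X → + q * halving-error - X) −Qadj-det) (cancel (D * D) (+ q * halving-error)))
             (∣m∣n⇒∣m-n (∣m⇒∣m*n halving-error (∣ᵤ⇒∣ {+ i} {+ q} i∣q)) (∣ᵤ⇒∣ {+ i} {det3 (matQ q −Qadj)} i∣det′))
      where
      cancel : ∀ X Y → Y - (- X + Y) ≡ X
      cancel = solve 2 (λ X Y → Y :- (:- X :+ Y) := X) refl
    i-coprime-D : Coprime i ∣ D ∣
    i-coprime-D {j} (j∣i , j∣D) = det-coprime (j∣D , ℕD.∣-trans j∣i i∣q)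
    i∣D : i ∣ℕ ∣ D ∣
    i∣D = coprime-divisor i-coprime-D (subst (i ∣ℕ_) (abs-* D D) (∣⇒∣ᵤ i∣D²))

  Isotropic : ℤ → ℤ → ℤ → Set
  Isotropic x₁ x₂ x₃ = NotAll (_≡ 0ℤ) x₁ x₂ x₃ × + q ∣ℤ Z.form a b c d e f x₁ x₂ x₃

  open MinimalVector Isotropic (λ x₁ x₂ x₃ → nonzero? x₁ x₂ x₃ ×-dec (+ q ∣? Z.form a b c d e f x₁ x₂ x₃))

  -- (q, 0, 0) is isotropic, so a least isotropic vector exists.
  q-isotropic : Isotropic (+ q) 0ℤ 0ℤ
  q-isotropic = (λ q≡0 _ _ → odd≢0 q q-odd (+-injective q≡0))
              , ∣-by (sym (on-axis a b c d e f (+ q))) (∣n⇒∣m*n (a * + q) ∣-refl)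
    where
    on-axis : ∀ a b c d e f u → Z.form a b c d e f u 0ℤ 0ℤ ≡ a * u * u
    on-axis = solve 7 (λ a b c d e f u → Syn.form a b c d e f u (con 0ℤ) (con 0ℤ) := a :* u :* u) refl

  -- The second assertion: a least isotropic vector x is no longer than the
  -- short vector produced for any y admissible for m̂(−Q^adj;q).
  least-isotropic-short : DetCoprime q Q →
    ∃[ x ] (IsotropicMod q (evalQ Q) x × ∃[ Q' ] (DetCoprime q Q' ×
      (∀ (y : Vec3) → SquareMod q (evalQ Q') y → normSq x * normSq x ≤ + κ * (+ q * + q) * normSq y)))
  least-isotropic-short det-coprime = from-least (minimal-vector (+ q) 0ℤ 0ℤ q-isotropic)
    where
    from-least : (Σ ℤ λ x₁ → Σ ℤ λ x₂ → Σ ℤ λ x₃ → Isotropic x₁ x₂ x₃ ×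
                   (∀ y₁ y₂ y₃ → Isotropic y₁ y₂ y₃ → norm² x₁ x₂ x₃ ℕ.≤ norm² y₁ y₂ y₃)) →
      ∃[ x ] (IsotropicMod q (evalQ Q) x × ∃[ Q' ] (DetCoprime q Q' ×
        (∀ (y : Vec3) → SquareMod q (evalQ Q') y → normSq x * normSq x ≤ + κ * (+ q * + q) * normSq y)))
    from-least (x₁ , x₂ , x₃ , (x≢0 , isotropic) , least-norm) =
      Z.vec3 x₁ x₂ x₃ , isotropic-vector x₁ x₂ x₃ x≢0 isotropic , −Qadj , −Qadj-det-coprime det-coprime , bound
      where
      bound : ∀ (y : Vec3) → SquareMod q (evalQ −Qadj) y → normSq (Z.vec3 x₁ x₂ x₃) * normSq (Z.vec3 x₁ x₂ x₃) ≤ + κ * (+ q * + q) * normSq y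
      bound y (y≢0 , t , square) = bound-in-normSq q x₁ x₂ x₃ y (ℕP.≤-trans (ℕP.*-mono-≤ x≤x′ x≤x′) short)
        where
        open ShortIsotropic (short-from-square y t y≢0 (∣-by (cong (_- t * t) (−Qadj-value y)) (∣ᵤ⇒∣ square)))
          using (short) renaming (x₁ to x₁′; x₂ to x₂′; x₃ to x₃′; x≢0 to x′≢0; isotropic to x′-isotropic)
        x≤x′ : norm² x₁ x₂ x₃ ℕ.≤ norm² x₁′ x₂′ x₃′
        x≤x′ = least-norm x₁′ x₂′ x₃′ (x′≢0 , x′-isotropic)

lemma1 : ∃[ K ]
    ( (∀ (q : ℕ) → Odd q → SquareFree q → ∀ (Q : Ternary) → DetCoprime q Q →
        ∀ (y : Vec3) → SquareMod q (λ v → - QadjEval q Q v) y →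
        ∃[ x ] (IsotropicMod q (evalQ Q) x
          × (normSq x * normSq x ≤ + K * (+ q * + q) * normSq y)))
    × (∀ (q : ℕ) → Odd q → SquareFree q → ∀ (Q : Ternary) → DetCoprime q Q →
        ∃[ x ] (IsotropicMod q (evalQ Q) x
          × ∃[ Q' ] (DetCoprime q Q'
            × (∀ (y : Vec3) → SquareMod q (evalQ Q') y →
                 normSq x * normSq x ≤ + K * (+ q * + q) * normSq y)))) )
lemma1 = κ
  , (λ q q-odd squarefree Q _ → Assertions.short-below-adjugate q q-odd squarefree Q)
  , (λ q q-odd squarefree Q → Assertions.least-isotropic-short q q-odd squarefree Q)
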